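{- Let $n\ge 1$ and let $\iota:B_n\to S_{2n}$ be the unfolding embedding. For any $w,v\in B_n$, $$\iota(w\star v)=\iota(w)\star\iota(v),$$ where the left-hand $\star$ is the Demazure product of $B_n$ and the right-hand $\star$ is the Demazure product of $S_{2n}$. Equivalently, $w\star v=\mathrm{fold}(\iota(w)\star\iota(v))$, where $\mathrm{fold}=\iota^{ -1}$ on the image of $\iota$.
   Context: $B_n$ is the group of signed permutations: bijections $w$ of $\{\pm1,\dots,\pm n\}$ with $w(-x)=-w(x)$. The product is composition. Its Coxeter generators are $s_1,\dots,s_n$: - for $i<n$, $s_i$ swaps $i\leftrightarrow i+1$ and $-i\leftrightarrow -(i+1)$; - $s_n$ swaps $n\leftrightarrow -n$. $S_{2n}$ is the symmetric group with Coxeter generators $s'_j=(j,j+1)$, $1\le j\le 2n-1$. Identify $\pm[n]$ with $[2n]$ via $k\mapsto k$ and $-k\mapsto 2n+1-k$ for $1\le k\le n$. The unfolding map $\iota$ sends $w$ to the corresponding permutation of $[2n]$. Its one-line notation is the relabeled sequence $w(1),\dots,w(n),-w(n),\dots,-w(1)$. This $\iota$ is the group embedding with $\iota(s_i)=s'_is'_{2n-i}$ for $i<n$ and $\iota(s_n)=s'_n$. In any Coxeter group $(W,S)$ with length $\ell$, the Demazure product $\star$ is the associative product determined by the following rules: - $s\star u=u$ if $\ell(su)<\ell(u)$, and $s\star u=su$ otherwise; - $w\star u=s_{a_1}\star(\cdots\star(s_{a_k}\star u))$ for any reduced word $w=s_{a_1}\cdots s_{a_k}$. -}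

module Defs where

open import Level using (0ℓ)
open import Data.Nat as ℕ using (ℕ; zero; suc; _+_; _*_; _<ᵇ_)
open import Data.Bool using (Bool; true; false; if_then_else_)
open import Data.Fin as Fin using (Fin; zero; suc; toℕ; fromℕ; fromℕ<; inject₁; _↑ˡ_; _↑ʳ_; splitAt; opposite)
open import Data.Fin.Properties as FinP using (all?; _≟_)
open import Data.Fin.Permutation as Perm using (Permutation′; _⟨$⟩ʳ_; _⟨$⟩ˡ_; _∘ₚ_; transpose; permutation; inverseˡ; inverseʳ)
open import Data.List using (List; []; _∷_; map; concatMap; length; allFin)
open import Data.Sum using (inj₁; inj₂)
open import Data.Product using (_×_; _,_)
open import Relation.Binary.PropositionalEquality using (_≡_; refl; cong; trans; sym)
open import Relation.Nullary using (Dec; yes; no; does)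
open import Relation.Nullary.Decidable using (map′)
open import Relation.Nullary.Decidable using (_×-dec_)

-- Length = minimal length of a word in the generators
-- (found by exhaustive search up to a bound that exceeds the maximal
-- Coxeter length of the group).

record FinGroupGens : Set₁ where
  field
    G      : Set
    _≈_    : G → G → Set
    _≈?_   : (x y : G) → Dec (x ≈ y)
    e      : G
    _·_    : G → G → G            -- (x · y) acts as x after y
    r      : ℕ
    gen    : Fin r → G
    bound  : ℕ                    -- ≥ maximal Coxeter length

module Coxeter (W : FinGroupGens) where
  open FinGroupGens W

  prod : List (Fin r) → G
  prod []       = e
  prod (a ∷ as) = gen a · prod as

  words : ℕ → List (List (Fin r))
  words zero    = [] ∷ []
  words (suc k) = concatMap (λ a → map (a ∷_) (words k)) (allFin r)

  findIn : List (List (Fin r)) → G → Bool × List (Fin r)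
  findIn []         w = false , []
  findIn (ws ∷ wss) w with prod ws ≈? w
  ... | yes _ = true , ws
  ... | no  _ = findIn wss w

  search : ℕ → ℕ → G → ℕ × List (Fin r)
  search zero     k w = k , []
  search (suc f)  k w with findIn (words k) w
  ... | true  , ws = k , ws
  ... | false , _  = search f (suc k) w

  ℓ : G → ℕ
  ℓ w with search (suc bound) 0 w
  ... | k , _ = k

  reducedWord : G → List (Fin r)
  reducedWord w with search (suc bound) 0 w
  ... | _ , ws = ws

  _⋆gen_ : Fin r → G → G
  a ⋆gen u = if ℓ (gen a · u) <ᵇ ℓ u then u else gen a · u

  ⋆word : List (Fin r) → G → G
  ⋆word []       u = u
  ⋆word (a ∷ as) u = a ⋆gen ⋆word as u

  _⋆_ : G → G → G
  w ⋆ u = ⋆word (reducedWord w) u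

≈P? : ∀ {m} (π σ : Permutation′ m) → Dec (π Perm.≈ σ)
≈P? π σ = all? (λ i → (π ⟨$⟩ʳ i) ≟ (σ ⟨$⟩ʳ i))

-- adjacent transposition s'_{j+1} = (j+1, j+2) for j : Fin (m-1) (0-indexed)
adjT : (m : ℕ) → Fin (ℕ.pred m) → Permutation′ m
adjT zero    ()
adjT (suc m) j = transpose (inject₁ j) (suc j)

Sym : ℕ → FinGroupGens
Sym m = record
  { G = Permutation′ m
  ; _≈_ = Perm._≈_
  ; _≈?_ = ≈P?
  ; e = Perm.id
  ; _·_ = λ π σ → σ ∘ₚ π        -- (π · σ)(i) = π (σ i)
  ; r = ℕ.pred m
  ; gen = adjT m
  ; bound = m * m
  }

-- pos k stands for +(k+1), neg k for -(k+1)
data ±Fin (n : ℕ) : Set where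
  pos neg : Fin n → ±Fin n

negate : ∀ {n} → ±Fin n → ±Fin n
negate (pos k) = neg k
negate (neg k) = pos k

record SignedPerm (n : ℕ) : Set where
  field
    fun    : ±Fin n → ±Fin n
    inv    : ±Fin n → ±Fin n
    inv-l  : ∀ x → inv (fun x) ≡ x
    inv-r  : ∀ x → fun (inv x) ≡ x
    odd    : ∀ x → fun (negate x) ≡ negate (fun x)
open SignedPerm public

_≈B_ : ∀ {n} → SignedPerm n → SignedPerm n → Set
w ≈B u = ∀ x → fun w x ≡ fun u x

±≟ : ∀ {n} (x y : ±Fin n) → Dec (x ≡ y)
±≟ (pos a) (pos b) = map′ (cong pos) (λ { refl → refl }) (a ≟ b)
±≟ (neg a) (neg b) = map′ (cong neg) (λ { refl → refl }) (a ≟ b)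
±≟ (pos a) (neg b) = no (λ ())
±≟ (neg a) (pos b) = no (λ ())

≈B? : ∀ {n} (w u : SignedPerm n) → Dec (w ≈B u)
≈B? w u = map′ (λ { f (pos k) → Data.Product.proj₁ (f k) ; f (neg k) → Data.Product.proj₂ (f k) })
               (λ f k → f (pos k) , f (neg k))
               (all? (λ k → ±≟ (fun w (pos k)) (fun u (pos k)) ×-dec ±≟ (fun w (neg k)) (fun u (neg k))))
  where import Data.Product

idB : ∀ {n} → SignedPerm n
idB = record { fun = λ x → x ; inv = λ x → x ; inv-l = λ _ → refl ; inv-r = λ _ → refl ; odd = λ _ → refl }

_·B_ : ∀ {n} → SignedPerm n → SignedPerm n → SignedPerm n
w ·B u = record
  { fun = λ x → fun w (fun u x)
  ; inv = λ x → inv u (inv w x)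
  ; inv-l = λ x → trans (cong (inv u) (inv-l w (fun u x))) (inv-l u x)
  ; inv-r = λ x → trans (cong (fun w) (inv-r u (inv w x))) (inv-r w x)
  ; odd = λ x → trans (cong (fun w) (odd u x)) (odd w (fun u x))
  }

liftB : ∀ {n} → Permutation′ n → SignedPerm n
liftB σ = record
  { fun = f ; inv = g
  ; inv-l = λ { (pos k) → cong pos (inverseˡ σ) ; (neg k) → cong neg (inverseˡ σ) }
  ; inv-r = λ { (pos k) → cong pos (inverseʳ σ) ; (neg k) → cong neg (inverseʳ σ) }
  ; odd = λ { (pos k) → refl ; (neg k) → refl }
  }
  where
  f g : _ → _
  f (pos k) = pos (σ ⟨$⟩ʳ k)
  f (neg k) = neg (σ ⟨$⟩ʳ k)
  g (pos k) = pos (σ ⟨$⟩ˡ k)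
  g (neg k) = neg (σ ⟨$⟩ˡ k)

flipLastFun : ∀ k → ±Fin (suc k) → ±Fin (suc k)
flipLastFun k (pos a) with a ≟ fromℕ k
... | yes _ = neg a
... | no  _ = pos a
flipLastFun k (neg a) with a ≟ fromℕ k
... | yes _ = pos a
... | no  _ = neg a

flipLast-invol : ∀ k x → flipLastFun k (flipLastFun k x) ≡ x
flipLast-invol k (pos a) with a ≟ fromℕ k
flipLast-invol k (pos a) | yes p with a ≟ fromℕ k
... | yes _ = refl
... | no ¬p = Data.Empty.⊥-elim (¬p p) where import Data.Empty
flipLast-invol k (pos a) | no ¬p with a ≟ fromℕ k
... | yes p = Data.Empty.⊥-elim (¬p p) where import Data.Empty
... | no _  = refl
flipLast-invol k (neg a) with a ≟ fromℕ k
flipLast-invol k (neg a) | yes p with a ≟ fromℕ k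
... | yes _ = refl
... | no ¬p = Data.Empty.⊥-elim (¬p p) where import Data.Empty
flipLast-invol k (neg a) | no ¬p with a ≟ fromℕ k
... | yes p = Data.Empty.⊥-elim (¬p p) where import Data.Empty
... | no _  = refl

flipLast-odd : ∀ k x → flipLastFun k (negate x) ≡ negate (flipLastFun k x)
flipLast-odd k (pos a) with a ≟ fromℕ k
... | yes _ = refl
... | no  _ = refl
flipLast-odd k (neg a) with a ≟ fromℕ k
... | yes _ = refl
... | no  _ = refl

flipLast : ∀ k → SignedPerm (suc k)
flipLast k = record
  { fun = flipLastFun k ; inv = flipLastFun k
  ; inv-l = flipLast-invol k ; inv-r = flipLast-invol k ; odd = flipLast-odd k }

-- Coxeter generators of B_n, 0-indexed by j : Fin n:
--   j with toℕ j < n-1  ↦  s_{j+1}  (swaps j+1 ↔ j+2 and -(j+1) ↔ -(j+2))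
--   j = n-1            ↦  s_n      (swaps n ↔ -n)
genB : (n : ℕ) → Fin n → SignedPerm n
genB (suc k) j with toℕ j ℕ.<? k
... | yes p = liftB (transpose (inject₁ (fromℕ< p)) (suc (fromℕ< p)))
... | no  _ = flipLast k

Hyp : ℕ → FinGroupGens
Hyp n = record
  { G = SignedPerm n
  ; _≈_ = _≈B_
  ; _≈?_ = ≈B?
  ; e = idB
  ; _·_ = _·B_
  ; r = n
  ; gen = genB n
  ; bound = (n + n) * (n + n)
  }

-- The unfolding map ι : B_n → S_{2n}
-- ±[n] ≅ [2n] (0-indexed): +(k+1) ↦ k,  -(k+1) ↦ 2n-1-k
-- (i.e. k ↦ k and -k ↦ 2n+1-k in 1-indexed notation)

encode : ∀ {n} → ±Fin n → Fin (n + n)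
encode {n} (pos k) = k ↑ˡ n
encode {n} (neg k) = n ↑ʳ opposite k

decode : ∀ {n} → Fin (n + n) → ±Fin n
decode {n} i with splitAt n i
... | inj₁ a = pos a
... | inj₂ b = neg (opposite b)

decode-encode : ∀ {n} x → decode {n} (encode x) ≡ x
decode-encode {n} (pos k) rewrite FinP.splitAt-↑ˡ n k n = refl
decode-encode {n} (neg k) rewrite FinP.splitAt-↑ʳ n n (opposite k) =
  cong neg (FinP.opposite-involutive k)

encode-decode : ∀ {n} i → encode {n} (decode i) ≡ i
encode-decode {n} i with splitAt n i in eq
... | inj₁ a = trans (cong (Fin.join n n) (sym eq)) (FinP.join-splitAt n n i)
... | inj₂ b = trans (cong (n ↑ʳ_) (FinP.opposite-involutive b))
                     (trans (cong (Fin.join n n) (sym eq)) (FinP.join-splitAt n n i))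

ι : ∀ {n} → SignedPerm n → Permutation′ (n + n)
ι {n} w = permutation
  (λ i → encode (fun w (decode i)))
  (λ i → encode (inv w (decode i)))
  (λ i → trans (cong (λ z → encode (fun w z)) (decode-encode _))
           (trans (cong encode (inv-r w (decode i))) (encode-decode {n} i)))
  (λ i → trans (cong (λ z → encode (inv w z)) (decode-encode _))
           (trans (cong encode (inv-l w (decode i))) (encode-decode {n} i)))

module CB (n : ℕ) = Coxeter (Hyp n)
module CS (m : ℕ) = Coxeter (Sym m)

_⋆B_ : ∀ {n} → SignedPerm n → SignedPerm n → SignedPerm n
_⋆B_ {n} = CB._⋆_ n

_⋆S_ : ∀ {m} → Permutation′ m → Permutation′ m → Permutation′ m
_⋆S_ {m} = CS._⋆_ m

-- For a permutation π of Fin m let N π be its rank matrix: N π p v counts the positions a < p with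
-- π a ≥ v.  Rank matrices determine permutations, and the Demazure product of S_m turns into their
-- min-plus product: N (s ⋆ y) = N s ⊙ N y is a computation at the single column that s changes,
-- and it propagates to N (x ⋆ y) = N x ⊙ N y along a reduced word of x.
--
-- For B_n the Coxeter length of X is (inv (ι X) + N (ι X) n n) / 2.  Each generator of B_n unfolds
-- to s′ₙ or to a commuting mirror pair s′ⱼ s′₂ₙ₋ⱼ whose factors are ascents or descents of ι X
-- simultaneously, so the same propagation gives N (ι (w ⋆ v)) = N (ι w) ⊙ N (ι v).  Comparing with
-- N (ι w ⋆ ι v) = N (ι w) ⊙ N (ι v) and using injectivity of N proves the theorem.

module Submission where

open import Defs
open import Data.Nat using (ℕ; zero; suc; pred; _+_; _*_; _∸_; _⊓_; _≤_; _<_; z≤n; s≤s; _≤?_; _<?_; _≟_; _<ᵇ_; ⌊_/2⌋)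
open import Data.Nat.Properties
open import Data.Fin using (Fin; zero; suc; toℕ; inject₁; fromℕ<; fromℕ; opposite)
open import Data.Fin.Properties using (toℕ-injective; toℕ<n; toℕ-inject₁; toℕ-fromℕ<; toℕ-fromℕ; toℕ-↑ˡ; toℕ-↑ʳ; opposite-prop; any?)
import Data.Fin.Properties as Fin
open import Data.Fin.Permutation using (Permutation′; _⟨$⟩ʳ_; _⟨$⟩ˡ_; inverseˡ; inverseʳ; _∘ₚ_)
import Data.Fin.Permutation as Perm
open import Data.Bool using (true; false; T)
open import Data.List using (List; []; _∷_; map; length; allFin)
open import Data.List.Membership.Propositional using (_∈_; lose)
open import Data.List.Membership.Propositional.Properties using (∈-map⁺; ∈-map⁻; ∈-concatMap⁺; ∈-concatMap⁻; ∈-allFin)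
open import Data.List.Relation.Unary.Any using (here; there)
open import Data.List.Relation.Unary.Any.Properties using (lookup-result)
open import Data.Product using (Σ-syntax; _×_; _,_; proj₁; proj₂)
open import Data.Sum using (_⊎_; inj₁; inj₂)
open import Data.Empty using (⊥-elim)
open import Function using (_∘_)
open import Level using (0ℓ)
open import Algebra.Bundles using (Semigroup)
open import Algebra.Properties.CommutativeMonoid.Sum +-0-commutativeMonoid using (sum; sum-syntax; sum-cong-≗; ∑-distrib-+; ∑-permute)
open import Relation.Binary.Structures using (IsEquivalence)
import Relation.Binary.Reasoning.Setoid as SetoidReasoning
open import Relation.Nullary using (¬_; Dec; yes; no)
open import Relation.Nullary.Decidable using (_×-dec_)
open import Relation.Binary.PropositionalEquality using (_≡_; _≢_; refl; sym; trans; cong; cong₂; subst; subst₂; ≢-sym; module ≡-Reasoning)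


𝟙 : ∀ {p} {P : Set p} → Dec P → ℕ
𝟙 (yes _) = 1
𝟙 (no _)  = 0

𝟙-yes : ∀ {p} {P : Set p} (d : Dec P) → P → 𝟙 d ≡ 1
𝟙-yes (yes _) _ = refl
𝟙-yes (no ¬p) p = ⊥-elim (¬p p)

𝟙-no : ∀ {p} {P : Set p} (d : Dec P) → ¬ P → 𝟙 d ≡ 0
𝟙-no (yes p) ¬p = ⊥-elim (¬p p)
𝟙-no (no _)  _  = refl

𝟙≤1 : ∀ {p} {P : Set p} (d : Dec P) → 𝟙 d ≤ 1
𝟙≤1 (yes _) = ≤-refl
𝟙≤1 (no _)  = z≤n

[_≤_] [_<_] [_≡_] : ℕ → ℕ → ℕ
[ a ≤ b ] = 𝟙 (a ≤? b)
[ a < b ] = 𝟙 (a <? b)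
[ a ≡ b ] = 𝟙 (a ≟ b)

sum-≤ : ∀ {m} {f g : Fin m → ℕ} → (∀ i → f i ≤ g i) → sum f ≤ sum g
sum-≤ {zero}  _ = z≤n
sum-≤ {suc m} h = +-mono-≤ (h zero) (sum-≤ (h ∘ suc))

sum-zero : ∀ {m} {f : Fin m → ℕ} → (∀ i → f i ≡ 0) → sum f ≡ 0
sum-zero {zero}  _ = refl
sum-zero {suc m} h = cong₂ _+_ (h zero) (sum-zero (h ∘ suc))

sum-const : ∀ {m} c → ∑[ _ < m ] c ≡ m * c
sum-const {zero}  c = refl
sum-const {suc m} c = cong (c +_) (sum-const {m} c)

sum-supported : ∀ {m} (c : Fin m) (f : Fin m → ℕ) → (∀ i → i ≢ c → f i ≡ 0) → sum f ≡ f c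
sum-supported zero    f h = trans (cong (f zero +_) (sum-zero (λ i → h (suc i) λ ()))) (+-identityʳ _)
sum-supported (suc c) f h = trans (cong (_+ sum (f ∘ suc)) (h zero λ ()))
  (sum-supported c (f ∘ suc) (λ i i≢c → h (suc i) (i≢c ∘ Fin.suc-injective)))

sum-≤-≡⇒≗ : ∀ {m} (f g : Fin m → ℕ) → (∀ i → f i ≤ g i) → sum f ≡ sum g → ∀ i → f i ≡ g i
sum-≤-≡⇒≗ f g f≤g ∑f≡∑g zero = ≤-antisym (f≤g zero)
  (+-cancelʳ-≤ (sum (g ∘ suc)) (g zero) (f zero)
    (≤-trans (≤-reflexive (sym ∑f≡∑g)) (+-monoʳ-≤ (f zero) (sum-≤ (f≤g ∘ suc)))))
sum-≤-≡⇒≗ f g f≤g ∑f≡∑g (suc i) = sum-≤-≡⇒≗ (f ∘ suc) (g ∘ suc) (f≤g ∘ suc)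
  (+-cancelˡ-≡ (f zero) _ _ (trans ∑f≡∑g (cong (_+ sum (g ∘ suc)) (sym f₀≡g₀)))) i
  where
  f₀≡g₀ : f zero ≡ g zero
  f₀≡g₀ = sum-≤-≡⇒≗ f g f≤g ∑f≡∑g zero

minUpTo : ℕ → (ℕ → ℕ) → ℕ
minUpTo zero    g = g 0
minUpTo (suc m) g = minUpTo m g ⊓ g (suc m)

minUpTo-≤ : ∀ m g {k} → k ≤ m → minUpTo m g ≤ g k
minUpTo-≤ zero    g z≤n = ≤-refl
minUpTo-≤ (suc m) g {k} k≤1+m with m<1+n⇒m<n∨m≡n (s≤s k≤1+m)
... | inj₁ k<1+m = ≤-trans (m⊓n≤m _ _) (minUpTo-≤ m g (≤-pred k<1+m))
... | inj₂ refl  = m⊓n≤n _ _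

minUpTo-attained : ∀ m g → Σ[ k ∈ ℕ ] k ≤ m × minUpTo m g ≡ g k
minUpTo-attained zero    g = 0 , z≤n , refl
minUpTo-attained (suc m) g with ⊓-sel (minUpTo m g) (g (suc m))
... | inj₂ min≡g = suc m , ≤-refl , min≡g
... | inj₁ min≡min with minUpTo-attained m g
...   | k , k≤m , e = k , m≤n⇒m≤1+n k≤m , trans min≡min e

minUpTo-greatest : ∀ m g {c} → (∀ {k} → k ≤ m → c ≤ g k) → c ≤ minUpTo m g
minUpTo-greatest zero    g h = h z≤n
minUpTo-greatest (suc m) g h = ⊓-glb (minUpTo-greatest m g (h ∘ m≤n⇒m≤1+n)) (h ≤-refl)

minUpTo-unique : ∀ m g {c k} → (∀ {k} → k ≤ m → c ≤ g k) → k ≤ m → g k ≡ c → minUpTo m g ≡ c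
minUpTo-unique m g h k≤m gk≡c =
  ≤-antisym (≤-trans (minUpTo-≤ m g k≤m) (≤-reflexive gk≡c)) (minUpTo-greatest m g h)

minUpTo-cong : ∀ m {g h : ℕ → ℕ} → (∀ {k} → k ≤ m → g k ≡ h k) → minUpTo m g ≡ minUpTo m h
minUpTo-cong zero    e = e z≤n
minUpTo-cong (suc m) e = cong₂ _⊓_ (minUpTo-cong m (e ∘ m≤n⇒m≤1+n)) (e ≤-refl)

Mat : Set
Mat = ℕ → ℕ → ℕ

_≐_ : Mat → Mat → Set
A ≐ B = ∀ p v → A p v ≡ B p v

≐-sym : ∀ {A B} → A ≐ B → B ≐ A
≐-sym A≐B p v = sym (A≐B p v)

≐-trans : ∀ {A B C} → A ≐ B → B ≐ C → A ≐ C
≐-trans A≐B B≐C p v = trans (A≐B p v) (B≐C p v)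

≐-isEquivalence : IsEquivalence _≐_
≐-isEquivalence = record { refl = λ _ _ → refl ; sym = ≐-sym ; trans = ≐-trans }

module MinPlus (m : ℕ) where

  _⊙_ : Mat → Mat → Mat
  (A ⊙ B) p v = minUpTo m (λ k → B p k + A k v)

  ⊙-cong : ∀ {A A′ B B′} → A ≐ A′ → B ≐ B′ → (A ⊙ B) ≐ (A′ ⊙ B′)
  ⊙-cong A≐A′ B≐B′ p v = minUpTo-cong m (λ {k} _ → cong₂ _+_ (B≐B′ p k) (A≐A′ k v))

  ⊙-congˡ : ∀ {A A′} B → A ≐ A′ → (A ⊙ B) ≐ (A′ ⊙ B)
  ⊙-congˡ B A≐A′ = ⊙-cong A≐A′ (λ _ _ → refl)

  ⊙-congʳ : ∀ A {B B′} → B ≐ B′ → (A ⊙ B) ≐ (A ⊙ B′)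
  ⊙-congʳ A B≐B′ = ⊙-cong (λ _ _ → refl) B≐B′

  ⊙-assoc : ∀ A B C → ((A ⊙ B) ⊙ C) ≐ (A ⊙ (B ⊙ C))
  ⊙-assoc A B C p v = ≤-antisym ≥-direction ≤-direction
    where
    open ≤-Reasoning
    ≤-direction : (A ⊙ (B ⊙ C)) p v ≤ ((A ⊙ B) ⊙ C) p v
    ≤-direction with minUpTo-attained m (λ l → C p l + (A ⊙ B) l v)
    ... | l , l≤m , eₗ with minUpTo-attained m (λ k → B l k + A k v)
    ... | k , k≤m , eₖ = begin
      (A ⊙ (B ⊙ C)) p v       ≤⟨ minUpTo-≤ m (λ k → (B ⊙ C) p k + A k v) k≤m ⟩
      (B ⊙ C) p k + A k v     ≤⟨ +-monoˡ-≤ (A k v) (minUpTo-≤ m (λ l → C p l + B l k) l≤m) ⟩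
      C p l + B l k + A k v   ≡⟨ +-assoc (C p l) (B l k) (A k v) ⟩
      C p l + (B l k + A k v) ≡⟨ sym (trans eₗ (cong (C p l +_) eₖ)) ⟩
      ((A ⊙ B) ⊙ C) p v       ∎
    ≥-direction : ((A ⊙ B) ⊙ C) p v ≤ (A ⊙ (B ⊙ C)) p v
    ≥-direction with minUpTo-attained m (λ k → (B ⊙ C) p k + A k v)
    ... | k , k≤m , eₖ with minUpTo-attained m (λ l → C p l + B l k)
    ... | l , l≤m , eₗ = begin
      ((A ⊙ B) ⊙ C) p v       ≤⟨ minUpTo-≤ m (λ l → C p l + (A ⊙ B) l v) l≤m ⟩
      C p l + (A ⊙ B) l v     ≤⟨ +-monoʳ-≤ (C p l) (minUpTo-≤ m (λ k → B l k + A k v) k≤m) ⟩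
      C p l + (B l k + A k v) ≡⟨ sym (+-assoc (C p l) (B l k) (A k v)) ⟩
      C p l + B l k + A k v   ≡⟨ sym (trans eₖ (cong (_+ A k v) eₗ)) ⟩
      (A ⊙ (B ⊙ C)) p v       ∎

  minPlusSemigroup : Semigroup 0ℓ 0ℓ
  minPlusSemigroup = record
    { Carrier     = Mat
    ; _≈_         = _≐_
    ; _∙_         = _⊙_
    ; isSemigroup = record
      { isMagma = record { isEquivalence = ≐-isEquivalence ; ∙-cong = ⊙-cong }
      ; assoc   = ⊙-assoc
      }
    }

module CoxeterLength (W : FinGroupGens) where
  open FinGroupGens W
  open Coxeter W

  record LengthFunction : Set where
    field
      ≈-isEquivalence : IsEquivalence _≈_
      gen-·-cong      : ∀ a {x y} → x ≈ y → (gen a · x) ≈ (gen a · y)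
      L               : G → ℕ
      L-cong          : ∀ {x y} → x ≈ y → L x ≡ L y
      L-e             : L e ≡ 0
      L-gen           : ∀ a u → L (gen a · u) ≡ suc (L u) ⊎ suc (L (gen a · u)) ≡ L u
      L-descent       : ∀ u → u ≈ e ⊎ Σ[ a ∈ Fin r ] Σ[ u′ ∈ G ] u ≈ (gen a · u′) × L u ≡ suc (L u′)
      L-bounded       : ∀ u → L u ≤ bound

  module _ (lengthFunction : LengthFunction) where
    open LengthFunction lengthFunction
    open IsEquivalence ≈-isEquivalence using () renaming (sym to ≈-sym; trans to ≈-trans)

    L-gen-≤ : ∀ a u → L (gen a · u) ≤ suc (L u)
    L-gen-≤ a u with L-gen a u
    ... | inj₁ up   = ≤-reflexive up
    ... | inj₂ down = ≤-trans (n≤1+n _) (≤-trans (n≤1+n _) (≤-reflexive (cong suc down)))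

    L-prod-≤ : ∀ ws → L (prod ws) ≤ length ws
    L-prod-≤ []       = ≤-reflexive L-e
    L-prod-≤ (a ∷ ws) = ≤-trans (L-gen-≤ a (prod ws)) (s≤s (L-prod-≤ ws))

    word-of-length-L : ∀ u → Σ[ ws ∈ List (Fin r) ] prod ws ≈ u × length ws ≡ L u
    word-of-length-L u = go (L u) u refl
      where
      go : ∀ k u → L u ≡ k → Σ[ ws ∈ List (Fin r) ] prod ws ≈ u × length ws ≡ L u
      go k u Lu≡k with L-descent u
      go k       u Lu≡k | inj₁ u≈e = [] , ≈-sym u≈e , sym (trans (L-cong u≈e) L-e)
      go zero    u Lu≡0 | inj₂ (a , u′ , _ , Lu≡1+) with trans (sym Lu≡0) Lu≡1+
      ... | ()
      go (suc k) u Lu≡k | inj₂ (a , u′ , u≈au′ , Lu≡1+) with go k u′ (cong pred (trans (sym Lu≡1+) Lu≡k))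
      ... | ws , ws≈u′ , |ws|≡ = a ∷ ws , ≈-trans (gen-·-cong a ws≈u′) (≈-sym u≈au′) , trans (cong suc |ws|≡) (sym Lu≡1+)

    length-words : ∀ k {ws} → ws ∈ words k → length ws ≡ k
    length-words zero    (here refl) = refl
    length-words (suc k) ws∈ with ∈-map⁻ (_ ∷_) (lookup-result (∈-concatMap⁻ (λ a → map (a ∷_) (words k)) {xs = allFin r} ws∈))
    ... | ws′ , ws′∈ , ws≡ = trans (cong length ws≡) (cong suc (length-words k ws′∈))

    ∈-words : ∀ ws → ws ∈ words (length ws)
    ∈-words []       = here refl
    ∈-words (a ∷ ws) = ∈-concatMap⁺ (λ b → map (b ∷_) (words (length ws))) {xs = allFin r}
      (lose (∈-allFin a) (∈-map⁺ (a ∷_) (∈-words ws)))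

    findIn-found : ∀ wss w {ws} → findIn wss w ≡ (true , ws) → prod ws ≈ w × ws ∈ wss
    findIn-found (ws ∷ wss) w eq with prod ws ≈? w
    findIn-found (ws ∷ wss) w refl | yes ws≈w = ws≈w , here refl
    ... | no _ with findIn-found wss w eq
    ...   | ws′≈w , ws′∈ = ws′≈w , there ws′∈

    findIn-notFound : ∀ wss w → proj₁ (findIn wss w) ≡ false → ∀ {ws} → ws ∈ wss → ¬ prod ws ≈ w
    findIn-notFound (ws ∷ wss) w eq ws∈ with prod ws ≈? w
    findIn-notFound (ws ∷ wss) w () ws∈         | yes _
    findIn-notFound (ws ∷ wss) w eq (here refl) | no ws≉w = ws≉w
    findIn-notFound (ws ∷ wss) w eq (there ws∈) | no _    = findIn-notFound wss w eq ws∈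

    search-correct : ∀ f k w → k ≤ L w → L w < k + f →
      let (k′ , ws) = search f k w in k′ ≡ L w × prod ws ≈ w × length ws ≡ L w
    search-correct zero k w k≤L L<k+0 = ⊥-elim (<⇒≱ (subst (L w <_) (+-identityʳ k) L<k+0) k≤L)
    search-correct (suc f) k w k≤L L<k+f with findIn (words k) w in eq
    ... | true , ws = k≡L , ws≈w , trans |ws|≡k k≡L
      where
      found = findIn-found (words k) w eq
      ws≈w = proj₁ found
      |ws|≡k = length-words k (proj₂ found)
      k≡L : k ≡ L w
      k≡L = ≤-antisym k≤L (subst (_≤ k) (L-cong ws≈w) (subst (L (prod ws) ≤_) |ws|≡k (L-prod-≤ ws)))
    ... | false , _ = search-correct f (suc k) w (≤∧≢⇒< k≤L k≢L) (subst (L w <_) (+-suc k f) L<k+f)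
      where
      k≢L : k ≢ L w
      k≢L k≡L with word-of-length-L w
      ... | ws , ws≈w , |ws|≡L = findIn-notFound (words k) w (cong proj₁ eq)
        (subst (λ z → ws ∈ words z) (trans |ws|≡L (sym k≡L)) (∈-words ws)) ws≈w

    private
      search-top : ∀ w → let (k′ , ws) = search (suc bound) 0 w in k′ ≡ L w × prod ws ≈ w × length ws ≡ L w
      search-top w = search-correct (suc bound) 0 w z≤n (s≤s (L-bounded w))

    ℓ≡L : ∀ w → ℓ w ≡ L w
    ℓ≡L w with search (suc bound) 0 w | search-top w
    ... | _ | ℓ≡ , _ , _ = ℓ≡

    prod-reducedWord : ∀ w → prod (reducedWord w) ≈ w
    prod-reducedWord w with search (suc bound) 0 w | search-top w
    ... | _ | _ , ws≈w , _ = ws≈w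

    Reduced : List (Fin r) → Set
    Reduced ws = length ws ≡ L (prod ws)

    reducedWord-reduced : ∀ w → Reduced (reducedWord w)
    reducedWord-reduced w with search (suc bound) 0 w | search-top w
    ... | _ | _ , ws≈w , |ws|≡L = trans |ws|≡L (L-cong (≈-sym ws≈w))

    reduced-tail : ∀ a ws → Reduced (a ∷ ws) → Reduced ws
    reduced-tail a ws red = ≤-antisym
      (≤-pred (subst (_≤ suc (L (prod ws))) (sym red) (L-gen-≤ a (prod ws))))
      (L-prod-≤ ws)

    reduced-ascent : ∀ a ws → Reduced (a ∷ ws) → L (gen a · prod ws) ≡ suc (L (prod ws))
    reduced-ascent a ws red = trans (sym red) (cong suc (reduced-tail a ws red))

    ⋆gen-ascent : ∀ a x → L (gen a · x) ≡ suc (L x) → (a ⋆gen x) ≡ (gen a · x)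
    ⋆gen-ascent a x up with ℓ (gen a · x) <ᵇ ℓ x in lt
    ... | false = refl
    ... | true  = ⊥-elim (<-asym (subst₂ _<_ (ℓ≡L _) (ℓ≡L x) (<ᵇ⇒< _ _ (subst T (sym lt) _)))
                                  (≤-reflexive (sym up)))

    ⋆gen-descent : ∀ a x → suc (L (gen a · x)) ≡ L x → (a ⋆gen x) ≡ x
    ⋆gen-descent a x down with ℓ (gen a · x) <ᵇ ℓ x in lt
    ... | true  = refl
    ... | false = ⊥-elim (subst T lt (<⇒<ᵇ (subst₂ _<_ (sym (ℓ≡L _)) (sym (ℓ≡L x)) (≤-reflexive down))))

    module _ (S : Semigroup 0ℓ 0ℓ) where
      open Semigroup S renaming (Carrier to A; _≈_ to _≃_; refl to ≃-refl; sym to ≃-sym; trans to ≃-trans)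
      open SetoidReasoning setoid


      ⋆-homomorphism : (Φ : G → A) (M : Fin r → A) →
        (∀ {x y} → x ≈ y → Φ x ≃ Φ y) →
        (∀ u → Φ u ≃ (Φ e ∙ Φ u)) →
        (∀ a x → Φ (a ⋆gen x) ≃ (M a ∙ Φ x)) →
        ∀ w u → Φ (w ⋆ u) ≃ (Φ w ∙ Φ u)
      ⋆-homomorphism Φ M Φ-cong Φ-e Φ-gen w u =
        ≃-trans (along (reducedWord w) (reducedWord-reduced w)) (∙-cong (Φ-cong (prod-reducedWord w)) ≃-refl)
        where
        along : ∀ ws → Reduced ws → Φ (⋆word ws u) ≃ (Φ (prod ws) ∙ Φ u)
        along []       _   = Φ-e u
        -- Each letter of a reduced word is an ascent of the word that follows it.
        along (a ∷ ws) red = begin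
          Φ (a ⋆gen ⋆word ws u)             ≈⟨ Φ-gen a (⋆word ws u) ⟩
          M a ∙ Φ (⋆word ws u)              ≈⟨ ∙-cong ≃-refl (along ws (reduced-tail a ws red)) ⟩
          M a ∙ (Φ (prod ws) ∙ Φ u)         ≈⟨ ≃-sym (assoc _ _ _) ⟩
          (M a ∙ Φ (prod ws)) ∙ Φ u         ≈⟨ ∙-cong (≃-sym (Φ-gen a (prod ws))) ≃-refl ⟩
          Φ (a ⋆gen prod ws) ∙ Φ u          ≡⟨ cong (λ z → Φ z ∙ Φ u) (⋆gen-ascent a (prod ws) (reduced-ascent a ws red)) ⟩
          Φ (gen a · prod ws) ∙ Φ u         ∎

swapℕ : ℕ → ℕ → ℕ
swapℕ j x with x ≟ j
... | yes _ = suc j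
... | no _ with x ≟ suc j
...   | yes _ = j
...   | no _  = x

swapℕ-j : ∀ j → swapℕ j j ≡ suc j
swapℕ-j j with j ≟ j
... | yes _  = refl
... | no j≢j = ⊥-elim (j≢j refl)

swapℕ-1+j : ∀ j → swapℕ j (suc j) ≡ j
swapℕ-1+j j with suc j ≟ j
... | yes 1+j≡j = ⊥-elim (1+n≢n 1+j≡j)
... | no _ with suc j ≟ suc j
...   | yes _ = refl
...   | no ≢  = ⊥-elim (≢ refl)

swapℕ-other : ∀ j x → x ≢ j → x ≢ suc j → swapℕ j x ≡ x
swapℕ-other j x x≢j x≢1+j with x ≟ j
... | yes x≡j = ⊥-elim (x≢j x≡j)
... | no _ with x ≟ suc j
...   | yes x≡1+j = ⊥-elim (x≢1+j x≡1+j)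
...   | no _      = refl

swapℕ-involutive : ∀ j x → swapℕ j (swapℕ j x) ≡ x
swapℕ-involutive j x with x ≟ j
... | yes refl = swapℕ-1+j j
... | no x≢j with x ≟ suc j
...   | yes refl  = swapℕ-j j
...   | no x≢1+j = swapℕ-other j x x≢j x≢1+j

swapℕ-comm : ∀ a b x → suc a < b → swapℕ a (swapℕ b x) ≡ swapℕ b (swapℕ a x)
swapℕ-comm a b x 1+a<b = go (x ≟ a) (x ≟ suc a) (x ≟ b) (x ≟ suc b)
  where
  a<b : a < b
  a<b = <-trans (n<1+n a) 1+a<b
  a≢b = <⇒≢ a<b
  a≢1+b = <⇒≢ (m<n⇒m<1+n a<b)
  1+a≢b = <⇒≢ 1+a<b
  1+a≢1+b = <⇒≢ (s≤s a<b)
  b≢a = ≢-sym a≢b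
  b≢1+a = ≢-sym 1+a≢b
  1+b≢a = ≢-sym a≢1+b
  1+b≢1+a = ≢-sym 1+a≢1+b
  go : Dec (x ≡ a) → Dec (x ≡ suc a) → Dec (x ≡ b) → Dec (x ≡ suc b) → swapℕ a (swapℕ b x) ≡ swapℕ b (swapℕ a x)
  go (yes refl) _ _ _ rewrite swapℕ-other b x a≢b a≢1+b | swapℕ-j a | swapℕ-other b (suc a) 1+a≢b 1+a≢1+b = refl
  go (no _) (yes refl) _ _ rewrite swapℕ-other b x 1+a≢b 1+a≢1+b | swapℕ-1+j a | swapℕ-other b a a≢b a≢1+b = refl
  go (no _) (no _) (yes refl) _ rewrite swapℕ-other a x b≢a b≢1+a | swapℕ-j b | swapℕ-other a (suc b) 1+b≢a 1+b≢1+a = refl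
  go (no _) (no _) (no _) (yes refl) rewrite swapℕ-other a x 1+b≢a 1+b≢1+a | swapℕ-1+j b | swapℕ-other a b b≢a b≢1+a = refl
  go (no x≢a) (no x≢1+a) (no x≢b) (no x≢1+b)
    rewrite swapℕ-other b x x≢b x≢1+b | swapℕ-other a x x≢a x≢1+a | swapℕ-other b x x≢b x≢1+b = refl

[≤]-split : ∀ v x → [ v ≤ x ] ≡ [ suc v ≤ x ] + [ x ≡ v ]
[≤]-split v x with x ≟ v
... | yes refl rewrite 𝟙-yes (v ≤? v) ≤-refl | 𝟙-no (suc v ≤? v) (n≮n v) = refl
... | no x≢v with v ≤? x
...   | yes v≤x rewrite 𝟙-yes (suc v ≤? x) (≤∧≢⇒< v≤x (≢-sym x≢v)) = refl
...   | no v≰x  rewrite 𝟙-no (suc v ≤? x) (v≰x ∘ <⇒≤) = refl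

[<]-suc : ∀ a p → [ a < suc p ] ≡ [ a < p ] + [ a ≡ p ]
[<]-suc a p with a ≟ p
... | yes refl rewrite 𝟙-yes (a <? suc a) (n<1+n a) | 𝟙-no (a <? a) (n≮n a) = refl
... | no a≢p with a <? suc p
...   | yes (s≤s a≤p) rewrite 𝟙-yes (a <? p) (≤∧≢⇒< a≤p a≢p) = refl
...   | no a≮1+p      rewrite 𝟙-no (a <? p) (a≮1+p ∘ m<n⇒m<1+n) = refl

[<]-irrefl : ∀ a → [ a < a ] ≡ 0
[<]-irrefl a = 𝟙-no (a <? a) (n≮n a)

[≤suc]-≢ : ∀ v j → v ≢ suc j → [ v ≤ suc j ] ≡ [ v ≤ j ]
[≤suc]-≢ v j v≢1+j with v ≤? j
... | yes v≤j rewrite 𝟙-yes (v ≤? suc j) (m≤n⇒m≤1+n v≤j) = refl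
... | no v≰j  rewrite 𝟙-no (v ≤? suc j) (λ v≤1+j → v≰j (≤-pred (≤∧≢⇒< v≤1+j v≢1+j))) = refl

[≤]-swapℕ : ∀ j v x → v ≢ suc j → [ v ≤ swapℕ j x ] ≡ [ v ≤ x ]
[≤]-swapℕ j v x v≢1+j with x ≟ j
... | yes refl = [≤suc]-≢ v j v≢1+j
... | no _ with x ≟ suc j
...   | yes refl = sym ([≤suc]-≢ v j v≢1+j)
...   | no _     = refl

[1+j≤]-swapℕ : ∀ j x → [ suc j ≤ swapℕ j x ] ≡ [ suc (suc j) ≤ x ] + [ x ≡ j ]
[1+j≤]-swapℕ j x with x ≟ j
... | yes refl rewrite 𝟙-yes (suc j ≤? suc j) ≤-refl | 𝟙-no (suc (suc j) ≤? j) (<⇒≱ (m<n⇒m<1+n (n<1+n j))) = refl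
... | no x≢j with x ≟ suc j
...   | yes refl rewrite 𝟙-no (suc j ≤? j) (n≮n j) | 𝟙-no (suc (suc j) ≤? suc j) (n≮n (suc j)) = refl
...   | no x≢1+j rewrite [≤]-split (suc j) x | 𝟙-no (x ≟ suc j) x≢1+j = refl

[<suc]-≢ : ∀ a j → a ≢ j → [ a < suc j ] ≡ [ a < j ]
[<suc]-≢ a j a≢j rewrite [<]-suc a j | 𝟙-no (a ≟ j) a≢j = +-identityʳ _

[suc<]-≢ : ∀ j x → x ≢ suc j → [ suc j < x ] ≡ [ j < x ]
[suc<]-≢ j x x≢1+j rewrite [≤]-split (suc j) x | 𝟙-no (x ≟ suc j) x≢1+j = sym (+-identityʳ _)

[<]-swapℕ : ∀ j x x′ → ¬ (x ≡ j × x′ ≡ suc j) → ¬ (x ≡ suc j × x′ ≡ j) →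
            [ swapℕ j x′ < swapℕ j x ] ≡ [ x′ < x ]
[<]-swapℕ j x x′ ¬j,1+j ¬1+j,j = go (x ≟ j) (x ≟ suc j) (x′ ≟ j) (x′ ≟ suc j)
  where
  go : Dec (x ≡ j) → Dec (x ≡ suc j) → Dec (x′ ≡ j) → Dec (x′ ≡ suc j) → [ swapℕ j x′ < swapℕ j x ] ≡ [ x′ < x ]
  go (yes refl) _          (yes refl) _          = trans ([<]-irrefl _) (sym ([<]-irrefl _))
  go (yes refl) _          (no _)     (yes refl) = ⊥-elim (¬j,1+j (refl , refl))
  go (yes refl) _          (no x′≢j)  (no x′≢1+j)
    rewrite swapℕ-j j | swapℕ-other j x′ x′≢j x′≢1+j = [<suc]-≢ x′ j x′≢j
  go (no _)     (yes refl) (yes refl) _          = ⊥-elim (¬1+j,j (refl , refl))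
  go (no _)     (yes refl) (no _)     (yes refl) = trans ([<]-irrefl _) (sym ([<]-irrefl _))
  go (no _)     (yes refl) (no x′≢j)  (no x′≢1+j)
    rewrite swapℕ-1+j j | swapℕ-other j x′ x′≢j x′≢1+j = sym ([<suc]-≢ x′ j x′≢j)
  go (no x≢j)   (no x≢1+j) (yes refl) _
    rewrite swapℕ-j j | swapℕ-other j x x≢j x≢1+j = [suc<]-≢ j x x≢1+j
  go (no x≢j)   (no x≢1+j) (no _)     (yes refl)
    rewrite swapℕ-1+j j | swapℕ-other j x x≢j x≢1+j = sym ([suc<]-≢ j x x≢1+j)
  go (no x≢j)   (no x≢1+j) (no x′≢j)  (no x′≢1+j)
    rewrite swapℕ-other j x x≢j x≢1+j | swapℕ-other j x′ x′≢j x′≢1+j = refl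

[≡]*[≡]-≢ : ∀ x j x′ k → ¬ (x ≡ j × x′ ≡ k) → [ x ≡ j ] * [ x′ ≡ k ] ≡ 0
[≡]*[≡]-≢ x j x′ k ¬x,x′ with x ≟ j | x′ ≟ k
... | yes x≡j | yes x′≡k = ⊥-elim (¬x,x′ (x≡j , x′≡k))
... | yes _   | no _     = refl
... | no _    | _        = refl

[<]-swapℕ-inversion : ∀ j x x′ →
  [ swapℕ j x′ < swapℕ j x ] + [ x ≡ suc j ] * [ x′ ≡ j ] ≡ [ x′ < x ] + [ x ≡ j ] * [ x′ ≡ suc j ]
[<]-swapℕ-inversion j x x′ with x ≟ j ×-dec x′ ≟ suc j | x ≟ suc j ×-dec x′ ≟ j
... | yes (refl , refl) | _
  rewrite swapℕ-j j | swapℕ-1+j j | 𝟙-yes (j <? suc j) (n<1+n j) | 𝟙-no (suc j <? j) (<-asym (n<1+n j))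
        | 𝟙-no (j ≟ suc j) (≢-sym 1+n≢n) | 𝟙-yes (j ≟ j) refl | 𝟙-yes (suc j ≟ suc j) refl = refl
... | no _ | yes (refl , refl)
  rewrite swapℕ-j j | swapℕ-1+j j | 𝟙-yes (j <? suc j) (n<1+n j) | 𝟙-no (suc j <? j) (<-asym (n<1+n j))
        | 𝟙-no (suc j ≟ j) (1+n≢n) | 𝟙-yes (j ≟ j) refl | 𝟙-yes (suc j ≟ suc j) refl = refl
... | no ¬j,1+j | no ¬1+j,j
  rewrite [<]-swapℕ j x x′ ¬j,1+j ¬1+j,j | [≡]*[≡]-≢ x (suc j) x′ j ¬1+j,j | [≡]*[≡]-≢ x j x′ (suc j) ¬j,1+j = refl

[<]*[≤]-split-at : ∀ a p v k x w → [ a < p ] * [ v ≤ w ] ≤ [ a < p ] * [ k ≤ x ] + [ x < k ] * [ v ≤ w ]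
[<]*[≤]-split-at a p v k x w with k ≤? x
... | yes _  = ≤-trans (*-monoʳ-≤ [ a < p ] (𝟙≤1 (v ≤? w))) (m≤m+n _ _)
... | no k≰x rewrite 𝟙-yes (x <? k) (≰⇒> k≰x) | *-zeroʳ [ a < p ] = *-monoˡ-≤ [ v ≤ w ] (𝟙≤1 (a <? p))

-- The reflection x ↦ M - x (written additively) conjugates swapℕ j into swapℕ j′.
swapℕ-mirror : ∀ {M} j j′ x a → suc (j + j′) ≡ M → x + a ≡ M → swapℕ j′ x + swapℕ j a ≡ M
swapℕ-mirror {M} j j′ x a 1+j+j′≡M x+a≡M = go (a ≟ j) (a ≟ suc j)
  where
  1+j′+j≡M : suc j′ + j ≡ M
  1+j′+j≡M = trans (cong suc (+-comm j′ j)) 1+j+j′≡M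
  j′+1+j≡M : j′ + suc j ≡ M
  j′+1+j≡M = trans (+-suc j′ j) 1+j′+j≡M
  x≡ : ∀ y → y + a ≡ M → x ≡ y
  x≡ y y+a≡M = +-cancelʳ-≡ a x y (trans x+a≡M (sym y+a≡M))
  a≡ : ∀ y → x + y ≡ M → a ≡ y
  a≡ y x+y≡M = +-cancelˡ-≡ x a y (trans x+a≡M (sym x+y≡M))
  go : Dec (a ≡ j) → Dec (a ≡ suc j) → swapℕ j′ x + swapℕ j a ≡ M
  go (yes refl) _ = trans (cong₂ _+_ (trans (cong (swapℕ j′) (x≡ (suc j′) 1+j′+j≡M)) (swapℕ-1+j j′)) (swapℕ-j j)) j′+1+j≡M
  go (no _) (yes refl) = trans (cong₂ _+_ (trans (cong (swapℕ j′) (x≡ j′ j′+1+j≡M)) (swapℕ-j j′)) (swapℕ-1+j j)) 1+j′+j≡M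
  go (no a≢j) (no a≢1+j) = trans (cong₂ _+_ (swapℕ-other j′ x x≢j′ x≢1+j′) (swapℕ-other j a a≢j a≢1+j)) x+a≡M
    where
    x≢j′ : x ≢ j′
    x≢j′ refl = a≢1+j (a≡ (suc j) (trans (+-suc x j) (trans (cong suc (+-comm x j)) 1+j+j′≡M)))
    x≢1+j′ : x ≢ suc j′
    x≢1+j′ refl = a≢j (a≡ j 1+j′+j≡M)

swapℕ-below : ∀ j x → x < j → swapℕ j x ≡ x
swapℕ-below j x x<j = swapℕ-other j x (<⇒≢ x<j) (<⇒≢ (m<n⇒m<1+n x<j))

swapℕ-above : ∀ j x → suc j < x → swapℕ j x ≡ x
swapℕ-above j x 1+j<x = swapℕ-other j x (≢-sym (<⇒≢ (<-trans (n<1+n j) 1+j<x))) (≢-sym (<⇒≢ 1+j<x))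

+-mirror-< : ∀ {a b p q} → a + q ≡ b + p → p < q → a < b
+-mirror-< a+q≡b+p p<q = ≰⇒> (λ b≤a → <-irrefl (sym a+q≡b+p) (+-mono-≤-< b≤a p<q))

-- Rank matrices and inversion numbers

rank : ∀ {m} → (Fin m → ℕ) → Mat
rank f p v = ∑[ a < _ ] ([ toℕ a < p ] * [ v ≤ f a ])

rank-cong : ∀ {m} {f g : Fin m → ℕ} → (∀ a → f a ≡ g a) → rank f ≐ rank g
rank-cong f≗g p v = sum-cong-≗ (λ a → cong (λ z → [ toℕ a < p ] * [ v ≤ z ]) (f≗g a))

positionsBelow : ∀ {m} → (Fin m → ℕ) → ℕ → ℕ → ℕ
positionsBelow f p v = ∑[ a < _ ] ([ toℕ a < p ] * [ f a ≡ v ])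

rank-suc-value : ∀ {m} (f : Fin m → ℕ) p v → rank f p v ≡ rank f p (suc v) + positionsBelow f p v
rank-suc-value f p v = trans
  (sum-cong-≗ (λ a → trans (cong ([ toℕ a < p ] *_) ([≤]-split v (f a))) (*-distribˡ-+ [ toℕ a < p ] _ _)))
  (∑-distrib-+ (λ a → [ toℕ a < p ] * [ suc v ≤ f a ]) (λ a → [ toℕ a < p ] * [ f a ≡ v ]))

rank-suc-position : ∀ {m} (f : Fin m → ℕ) c v → rank f (suc (toℕ c)) v ≡ rank f (toℕ c) v + [ v ≤ f c ]
rank-suc-position f c v = begin
  rank f (suc (toℕ c)) v
    ≡⟨ sum-cong-≗ (λ a → trans (cong (_* [ v ≤ f a ]) ([<]-suc (toℕ a) (toℕ c)))
                                (*-distribʳ-+ [ v ≤ f a ] [ toℕ a < toℕ c ] [ toℕ a ≡ toℕ c ])) ⟩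
  ∑[ a < _ ] ([ toℕ a < toℕ c ] * [ v ≤ f a ] + [ toℕ a ≡ toℕ c ] * [ v ≤ f a ])
    ≡⟨ ∑-distrib-+ (λ a → [ toℕ a < toℕ c ] * [ v ≤ f a ]) (λ a → [ toℕ a ≡ toℕ c ] * [ v ≤ f a ]) ⟩
  rank f (toℕ c) v + ∑[ a < _ ] ([ toℕ a ≡ toℕ c ] * [ v ≤ f a ])
    ≡⟨ cong (rank f (toℕ c) v +_) (sum-supported c _ off-c) ⟩
  rank f (toℕ c) v + [ toℕ c ≡ toℕ c ] * [ v ≤ f c ]
    ≡⟨ cong (λ z → rank f (toℕ c) v + z * [ v ≤ f c ]) (𝟙-yes (toℕ c ≟ toℕ c) refl) ⟩
  rank f (toℕ c) v + 1 * [ v ≤ f c ]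
    ≡⟨ cong (rank f (toℕ c) v +_) (*-identityˡ _) ⟩
  rank f (toℕ c) v + [ v ≤ f c ] ∎
  where
  open ≡-Reasoning
  off-c : ∀ a → a ≢ c → [ toℕ a ≡ toℕ c ] * [ v ≤ f a ] ≡ 0
  off-c a a≢c rewrite 𝟙-no (toℕ a ≟ toℕ c) (a≢c ∘ toℕ-injective) = refl

rank-injective : ∀ {m} (f g : Fin m → ℕ) → rank f ≐ rank g → ∀ c → f c ≡ g c
rank-injective f g rf≐rg c = ≤-antisym (below g f (≐-sym rf≐rg)) (below f g rf≐rg)
  where
  below : ∀ f g → rank f ≐ rank g → g c ≤ f c
  below f g rf≐rg with g c ≤? f c
  ... | yes gc≤fc = gc≤fc
  ... | no gc≰fc = ⊥-elim (0≢1+n (trans (sym (𝟙-no (g c ≤? f c) gc≰fc)) (trans indicators-agree (𝟙-yes (g c ≤? g c) ≤-refl))))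
    where
    indicators-agree : [ g c ≤ f c ] ≡ [ g c ≤ g c ]
    indicators-agree = +-cancelˡ-≡ (rank f (toℕ c) (g c)) _ _ (begin
      rank f (toℕ c) (g c) + [ g c ≤ f c ]  ≡⟨ sym (rank-suc-position f c (g c)) ⟩
      rank f (suc (toℕ c)) (g c)            ≡⟨ rf≐rg (suc (toℕ c)) (g c) ⟩
      rank g (suc (toℕ c)) (g c)            ≡⟨ rank-suc-position g c (g c) ⟩
      rank g (toℕ c) (g c) + [ g c ≤ g c ]  ≡⟨ cong (_+ [ g c ≤ g c ]) (sym (rf≐rg (toℕ c) (g c))) ⟩
      rank f (toℕ c) (g c) + [ g c ≤ g c ]  ∎)
      where open ≡-Reasoning

rank-swapℕ : ∀ {m} (f : Fin m → ℕ) j p v → v ≢ suc j → rank (swapℕ j ∘ f) p v ≡ rank f p v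
rank-swapℕ f j p v v≢1+j = sum-cong-≗ (λ a → cong ([ toℕ a < p ] *_) ([≤]-swapℕ j v (f a) v≢1+j))

rank-swapℕ-1+j : ∀ {m} (f : Fin m → ℕ) j p →
  rank (swapℕ j ∘ f) p (suc j) ≡ rank f p (suc (suc j)) + positionsBelow f p j
rank-swapℕ-1+j f j p = trans
  (sum-cong-≗ (λ a → trans (cong ([ toℕ a < p ] *_) ([1+j≤]-swapℕ j (f a))) (*-distribˡ-+ [ toℕ a < p ] _ _)))
  (∑-distrib-+ (λ a → [ toℕ a < p ] * [ suc (suc j) ≤ f a ]) (λ a → [ toℕ a < p ] * [ f a ≡ j ]))

rank-bounded-values : ∀ {m} (f : Fin m → ℕ) → (∀ a → f a < m) → ∀ p {v} → m ≤ v → rank f p v ≡ 0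
rank-bounded-values {m} f f<m p {v} m≤v = sum-zero (λ a →
  trans (cong ([ toℕ a < p ] *_) (𝟙-no (v ≤? f a) (<⇒≱ (<-≤-trans (f<m a) m≤v)))) (*-zeroʳ [ toℕ a < p ]))

rank-toℕ : ∀ {m} {k v} → k ≤ v → rank {m} toℕ k v ≡ 0
rank-toℕ {m} {k} {v} k≤v = sum-zero {m} (λ a → term (toℕ a))
  where
  term : ∀ x → [ x < k ] * [ v ≤ x ] ≡ 0
  term x with x <? k
  ... | no _    = refl
  ... | yes x<k rewrite 𝟙-no (v ≤? x) (<⇒≱ (<-≤-trans x<k k≤v)) = refl

rank-≤ : ∀ {m} (f : Fin m → ℕ) p v → rank f p v ≤ m
rank-≤ {m} f p v = ≤-trans (sum-≤ {g = λ _ → 1} (λ a → *-mono-≤ (𝟙≤1 (toℕ a <? p)) (𝟙≤1 (v ≤? f a))))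
                           (≤-reflexive (trans (sum-const {m} 1) (*-identityʳ m)))

value : ∀ {m} → Permutation′ m → Fin m → ℕ
value π a = toℕ (π ⟨$⟩ʳ a)

rankMatrix : ∀ {m} → Permutation′ m → Mat
rankMatrix π = rank (value π)

rankMatrix-cong : ∀ {m} {π σ : Permutation′ m} → π Perm.≈ σ → rankMatrix π ≐ rankMatrix σ
rankMatrix-cong π≈σ = rank-cong (λ a → cong toℕ (π≈σ a))

rankMatrix-injective : ∀ {m} (π σ : Permutation′ m) → rankMatrix π ≐ rankMatrix σ → π Perm.≈ σ
rankMatrix-injective π σ eq a = toℕ-injective (rank-injective (value π) (value σ) eq a)

rankMatrix-large : ∀ {m} (π : Permutation′ m) p {v} → m ≤ v → rankMatrix π p v ≡ 0
rankMatrix-large π = rank-bounded-values (value π) (λ a → toℕ<n _)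

[value≡]-other : ∀ {m} (π : Permutation′ m) c {v} → toℕ c ≡ v → ∀ a → a ≢ π ⟨$⟩ˡ c → [ value π a ≡ v ] ≡ 0
[value≡]-other π c refl a a≢π⁻¹c = 𝟙-no (value π a ≟ toℕ c)
  (λ πa≡c → a≢π⁻¹c (trans (sym (inverseˡ π)) (cong (π ⟨$⟩ˡ_) (toℕ-injective πa≡c))))

[value≡]-inverse : ∀ {m} (π : Permutation′ m) c {v} → toℕ c ≡ v → [ value π (π ⟨$⟩ˡ c) ≡ v ] ≡ 1
[value≡]-inverse π c refl = 𝟙-yes (value π (π ⟨$⟩ˡ c) ≟ toℕ c) (cong toℕ (inverseʳ π))

positionsBelow-value : ∀ {m} (π : Permutation′ m) c {v} → toℕ c ≡ v → ∀ p →
  positionsBelow (value π) p v ≡ [ toℕ (π ⟨$⟩ˡ c) < p ]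
positionsBelow-value π c c≡v p = begin
  positionsBelow (value π) p _
    ≡⟨ sum-supported (π ⟨$⟩ˡ c) _ (λ a a≢ →
         trans (cong ([ toℕ a < p ] *_) ([value≡]-other π c c≡v a a≢)) (*-zeroʳ [ toℕ a < p ])) ⟩
  [ toℕ (π ⟨$⟩ˡ c) < p ] * [ value π (π ⟨$⟩ˡ c) ≡ _ ]
    ≡⟨ cong ([ toℕ (π ⟨$⟩ˡ c) < p ] *_) ([value≡]-inverse π c c≡v) ⟩
  [ toℕ (π ⟨$⟩ˡ c) < p ] * 1
    ≡⟨ *-identityʳ _ ⟩
  [ toℕ (π ⟨$⟩ˡ c) < p ] ∎
  where open ≡-Reasoning

adjT-value : ∀ {m′} (j : Fin m′) i → value (adjT (suc m′) j) i ≡ swapℕ (toℕ j) (toℕ i)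
adjT-value j i with i Fin.≟ inject₁ j
... | yes refl rewrite toℕ-inject₁ j | swapℕ-j (toℕ j) = refl
... | no i≢j with i Fin.≟ suc j
...   | yes refl rewrite toℕ-inject₁ j | swapℕ-1+j (toℕ j) = refl
...   | no i≢1+j = sym (swapℕ-other (toℕ j) (toℕ i)
          (λ i≡j → i≢j (toℕ-injective (trans i≡j (sym (toℕ-inject₁ j)))))
          (i≢1+j ∘ toℕ-injective))

rankMatrix-∘ₚ-≤ : ∀ {m} (u w : Permutation′ m) p v k → rankMatrix (u ∘ₚ w) p v ≤ rankMatrix u p k + rankMatrix w k v
rankMatrix-∘ₚ-≤ u w p v k = begin
  rankMatrix (u ∘ₚ w) p v
    ≤⟨ sum-≤ (λ a → [<]*[≤]-split-at (toℕ a) p v k (value u a) (value w (u ⟨$⟩ʳ a))) ⟩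
  ∑[ a < _ ] ([ toℕ a < p ] * [ k ≤ value u a ] + [ value u a < k ] * [ v ≤ value w (u ⟨$⟩ʳ a) ])
    ≡⟨ ∑-distrib-+ (λ a → [ toℕ a < p ] * [ k ≤ value u a ]) (λ a → [ value u a < k ] * [ v ≤ value w (u ⟨$⟩ʳ a) ]) ⟩
  rankMatrix u p k + ∑[ a < _ ] ([ value u a < k ] * [ v ≤ value w (u ⟨$⟩ʳ a) ])
    ≡⟨ cong (rankMatrix u p k +_) (sym (∑-permute (λ b → [ toℕ b < k ] * [ v ≤ value w b ]) u)) ⟩
  rankMatrix u p k + rankMatrix w k v ∎
  where open ≤-Reasoning

inversions : ∀ {m} → Permutation′ m → ℕ
inversions π = ∑[ a < _ ] ∑[ b < _ ] ([ toℕ a < toℕ b ] * [ value π b < value π a ])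

inversions-cong : ∀ {m} {π σ : Permutation′ m} → π Perm.≈ σ → inversions π ≡ inversions σ
inversions-cong π≈σ = sum-cong-≗ (λ a → sum-cong-≗ (λ b →
  cong₂ (λ x y → [ toℕ a < toℕ b ] * [ x < y ]) (cong toℕ (π≈σ b)) (cong toℕ (π≈σ a))))

∑∑-distrib-+ : ∀ {m} (F G : Fin m → Fin m → ℕ) →
  ∑[ a < m ] ∑[ b < m ] (F a b + G a b) ≡ ∑[ a < m ] ∑[ b < m ] F a b + ∑[ a < m ] ∑[ b < m ] G a b
∑∑-distrib-+ F G = trans (sum-cong-≗ (λ a → ∑-distrib-+ (F a) (G a))) (∑-distrib-+ (λ a → sum (F a)) (λ a → sum (G a)))

orderedPairs-value : ∀ {m} (π : Permutation′ m) c d {vc vd} → toℕ c ≡ vc → toℕ d ≡ vd →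
  ∑[ a < m ] ∑[ b < m ] ([ toℕ a < toℕ b ] * ([ value π a ≡ vc ] * [ value π b ≡ vd ]))
    ≡ [ toℕ (π ⟨$⟩ˡ c) < toℕ (π ⟨$⟩ˡ d) ]
orderedPairs-value π c d {vc} {vd} c≡ d≡ = begin
  _ ≡⟨ sum-cong-≗ (λ a → sum-supported (π ⟨$⟩ˡ d) _ (λ b b≢ → off-d a b b≢)) ⟩
  _ ≡⟨ sum-supported (π ⟨$⟩ˡ c) _ off-c ⟩
  _ ≡⟨ cong ([ toℕ (π ⟨$⟩ˡ c) < toℕ (π ⟨$⟩ˡ d) ] *_)
         (cong₂ _*_ ([value≡]-inverse π c c≡) ([value≡]-inverse π d d≡)) ⟩
  _ ≡⟨ *-identityʳ _ ⟩
  _ ∎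
  where
  open ≡-Reasoning
  off-d : ∀ a b → b ≢ π ⟨$⟩ˡ d → [ toℕ a < toℕ b ] * ([ value π a ≡ vc ] * [ value π b ≡ vd ]) ≡ 0
  off-d a b b≢ rewrite [value≡]-other π d d≡ b b≢ | *-zeroʳ [ value π a ≡ vc ] = *-zeroʳ [ toℕ a < toℕ b ]
  off-c : ∀ a → a ≢ π ⟨$⟩ˡ c →
    [ toℕ a < toℕ (π ⟨$⟩ˡ d) ] * ([ value π a ≡ vc ] * [ value π (π ⟨$⟩ˡ d) ≡ vd ]) ≡ 0
  off-c a a≢ rewrite [value≡]-other π c c≡ a a≢ = *-zeroʳ [ toℕ a < toℕ (π ⟨$⟩ˡ d) ]

inversions-adjT : ∀ {m′} (j : Fin m′) (y : Permutation′ (suc m′)) →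
  let p = toℕ (y ⟨$⟩ˡ inject₁ j) ; q = toℕ (y ⟨$⟩ˡ suc j) in
  inversions (y ∘ₚ adjT (suc m′) j) + [ q < p ] ≡ inversions y + [ p < q ]
inversions-adjT {m′} j y = begin
  inversions (y ∘ₚ adjT _ j) + [ q < p ]
    ≡⟨ cong₂ _+_ (sum-cong-≗ (λ a → sum-cong-≗ (λ b → cong₂ (λ x z → [ toℕ a < toℕ b ] * [ x < z ])
                    (adjT-value j (y ⟨$⟩ʳ b)) (adjT-value j (y ⟨$⟩ʳ a)))))
                 (sym (orderedPairs-value y (suc j) (inject₁ j) refl (toℕ-inject₁ j))) ⟩
  ∑∑ swappedInversion + ∑∑ descentPair      ≡⟨ sym (∑∑-distrib-+ swappedInversion descentPair) ⟩
  ∑∑ (λ a b → swappedInversion a b + descentPair a b)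
    ≡⟨ sum-cong-≗ (λ a → sum-cong-≗ (λ b → pointwise (toℕ a) (toℕ b) (value y a) (value y b))) ⟩
  ∑∑ (λ a b → inversion a b + ascentPair a b) ≡⟨ ∑∑-distrib-+ inversion ascentPair ⟩
  inversions y + ∑∑ ascentPair
    ≡⟨ cong (inversions y +_) (orderedPairs-value y (inject₁ j) (suc j) (toℕ-inject₁ j) refl) ⟩
  inversions y + [ p < q ] ∎
  where
  open ≡-Reasoning
  jn = toℕ j
  p = toℕ (y ⟨$⟩ˡ inject₁ j)
  q = toℕ (y ⟨$⟩ˡ suc j)
  ∑∑ : (Fin (suc m′) → Fin (suc m′) → ℕ) → ℕ
  ∑∑ F = ∑[ a < suc m′ ] ∑[ b < suc m′ ] F a b
  swappedInversion descentPair inversion ascentPair : Fin (suc m′) → Fin (suc m′) → ℕ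
  swappedInversion a b = [ toℕ a < toℕ b ] * [ swapℕ jn (value y b) < swapℕ jn (value y a) ]
  descentPair      a b = [ toℕ a < toℕ b ] * ([ value y a ≡ suc jn ] * [ value y b ≡ jn ])
  inversion        a b = [ toℕ a < toℕ b ] * [ value y b < value y a ]
  ascentPair       a b = [ toℕ a < toℕ b ] * ([ value y a ≡ jn ] * [ value y b ≡ suc jn ])
  pointwise : ∀ a b x x′ →
    [ a < b ] * [ swapℕ jn x′ < swapℕ jn x ] + [ a < b ] * ([ x ≡ suc jn ] * [ x′ ≡ jn ])
      ≡ [ a < b ] * [ x′ < x ] + [ a < b ] * ([ x ≡ jn ] * [ x′ ≡ suc jn ])
  pointwise a b x x′ = begin
    _ ≡⟨ sym (*-distribˡ-+ [ a < b ] _ _) ⟩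
    _ ≡⟨ cong ([ a < b ] *_) ([<]-swapℕ-inversion jn x x′) ⟩
    _ ≡⟨ *-distribˡ-+ [ a < b ] _ _ ⟩
    _ ∎

module SymmetricGroup (m′ : ℕ) where
  m : ℕ
  m = suc m′

  open FinGroupGens (Sym m) using (gen; _·_)
  open Coxeter (Sym m)
  open CoxeterLength (Sym m)

  posⱼ posⱼ₊₁ : Permutation′ m → Fin m′ → ℕ
  posⱼ   y j = toℕ (y ⟨$⟩ˡ inject₁ j)
  posⱼ₊₁ y j = toℕ (y ⟨$⟩ˡ suc j)

  Ascent Descent : Permutation′ m → Fin m′ → Set
  Ascent  y j = posⱼ y j < posⱼ₊₁ y j
  Descent y j = posⱼ₊₁ y j < posⱼ y j

  posⱼ≢posⱼ₊₁ : ∀ y j → posⱼ y j ≢ posⱼ₊₁ y j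
  posⱼ≢posⱼ₊₁ y j eq = 1+n≢n (sym (trans (sym (toℕ-inject₁ j)) (cong toℕ (begin
    inject₁ j                    ≡⟨ sym (inverseʳ y) ⟩
    y ⟨$⟩ʳ (y ⟨$⟩ˡ inject₁ j)    ≡⟨ cong (y ⟨$⟩ʳ_) (toℕ-injective eq) ⟩
    y ⟨$⟩ʳ (y ⟨$⟩ˡ suc j)        ≡⟨ inverseʳ y ⟩
    suc j                        ∎))))
    where open ≡-Reasoning

  inversions-ascent : ∀ j y → Ascent y j → inversions (gen j · y) ≡ suc (inversions y)
  inversions-ascent j y p<q = begin
    inversions (gen j · y)                                ≡⟨ sym (+-identityʳ _) ⟩
    inversions (gen j · y) + 0                            ≡⟨ cong (inversions (gen j · y) +_) (sym (𝟙-no (_ <? _) (<-asym p<q))) ⟩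
    inversions (gen j · y) + [ posⱼ₊₁ y j < posⱼ y j ]    ≡⟨ inversions-adjT j y ⟩
    inversions y + [ posⱼ y j < posⱼ₊₁ y j ]              ≡⟨ cong (inversions y +_) (𝟙-yes (_ <? _) p<q) ⟩
    inversions y + 1                                      ≡⟨ +-comm (inversions y) 1 ⟩
    suc (inversions y)                                    ∎
    where open ≡-Reasoning

  inversions-descent : ∀ j y → Descent y j → suc (inversions (gen j · y)) ≡ inversions y
  inversions-descent j y q<p = begin
    suc (inversions (gen j · y))                          ≡⟨ +-comm 1 _ ⟩
    inversions (gen j · y) + 1                            ≡⟨ cong (inversions (gen j · y) +_) (sym (𝟙-yes (_ <? _) q<p)) ⟩
    inversions (gen j · y) + [ posⱼ₊₁ y j < posⱼ y j ]    ≡⟨ inversions-adjT j y ⟩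
    inversions y + [ posⱼ y j < posⱼ₊₁ y j ]              ≡⟨ cong (inversions y +_) (𝟙-no (_ <? _) (<-asym q<p)) ⟩
    inversions y + 0                                      ≡⟨ +-identityʳ _ ⟩
    inversions y                                          ∎
    where open ≡-Reasoning

  ¬Ascent⇒Descent : ∀ y j → ¬ Ascent y j → Descent y j
  ¬Ascent⇒Descent y j p≮q = ≤∧≢⇒< (≮⇒≥ p≮q) (posⱼ≢posⱼ₊₁ y j ∘ sym)

  -- Without descents the positions u⁻¹ 0 < u⁻¹ 1 < ⋯ satisfy u⁻¹ i ≥ i, and equal sums force equality.
  no-descent⇒id : ∀ u → (∀ j → Ascent u j) → u Perm.≈ Perm.id
  no-descent⇒id u ascent i = trans (cong (u ⟨$⟩ʳ_) (sym (positions-fixed i))) (inverseʳ u)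
    where
    position-≥ : ∀ k (i : Fin m) → toℕ i ≡ k → k ≤ toℕ (u ⟨$⟩ˡ i)
    position-≥ zero    i       _ = z≤n
    position-≥ (suc k) (suc j) i≡1+k = ≤-trans
      (s≤s (position-≥ k (inject₁ j) (trans (toℕ-inject₁ j) (suc-injective i≡1+k)))) (ascent j)
    positions-fixed : ∀ i → u ⟨$⟩ˡ i ≡ i
    positions-fixed i = toℕ-injective (sym (sum-≤-≡⇒≗ toℕ (toℕ ∘ (u ⟨$⟩ˡ_))
      (λ i → position-≥ (toℕ i) i refl) (∑-permute toℕ (Perm.flip u)) i))

  inversions-id : inversions (Perm.id {m}) ≡ 0
  inversions-id = sum-zero {m} (λ a → sum-zero {m} (λ b → not-both (toℕ a) (toℕ b)))
    where
    not-both : ∀ x y → [ x < y ] * [ y < x ] ≡ 0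
    not-both x y with x <? y
    ... | no _    = refl
    ... | yes x<y rewrite 𝟙-no (y <? x) (<-asym x<y) = refl

  inversions-bounded : ∀ u → inversions u ≤ m * m
  inversions-bounded u = begin
    inversions u                 ≤⟨ sum-≤ {m} (λ a → sum-≤ {m} {g = λ _ → 1} (λ b →
                                      *-mono-≤ (𝟙≤1 (toℕ a <? toℕ b)) (𝟙≤1 (value u b <? value u a)))) ⟩
    ∑[ _ < m ] ∑[ _ < m ] 1      ≡⟨ sum-cong-≗ {m} (λ _ → trans (sum-const {m} 1) (*-identityʳ m)) ⟩
    ∑[ _ < m ] m                 ≡⟨ sum-const {m} m ⟩
    m * m                        ∎
    where open ≤-Reasoning

  inversionLength : LengthFunction
  inversionLength = record
    { ≈-isEquivalence = record { refl = λ {π} i → refl ; sym = λ e i → sym (e i) ; trans = λ e f i → trans (e i) (f i) }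
    ; gen-·-cong      = λ a e i → cong (gen a ⟨$⟩ʳ_) (e i)
    ; L               = inversions
    ; L-cong          = λ {π} {σ} → inversions-cong {m} {π} {σ}
    ; L-e             = inversions-id
    ; L-gen           = L-gen
    ; L-descent       = L-descent
    ; L-bounded       = inversions-bounded
    }
    where
    L-gen : ∀ j u → inversions (gen j · u) ≡ suc (inversions u) ⊎ suc (inversions (gen j · u)) ≡ inversions u
    L-gen j u with posⱼ u j <? posⱼ₊₁ u j
    ... | yes asc  = inj₁ (inversions-ascent j u asc)
    ... | no ¬asc = inj₂ (inversions-descent j u (¬Ascent⇒Descent u j ¬asc))
    L-descent : ∀ u → u Perm.≈ Perm.id ⊎
      Σ[ j ∈ Fin m′ ] Σ[ u′ ∈ Permutation′ m ] u Perm.≈ (gen j · u′) × inversions u ≡ suc (inversions u′)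
    L-descent u with any? (λ j → posⱼ₊₁ u j <? posⱼ u j)
    ... | yes (j , desc) = inj₂ (j , gen j · u , gen-involutive , sym (inversions-descent j u desc))
      where
      gen-involutive : u Perm.≈ (gen j · (gen j · u))
      gen-involutive i = toℕ-injective (sym (begin
        value (adjT m j) (adjT m j ⟨$⟩ʳ (u ⟨$⟩ʳ i))    ≡⟨ adjT-value j (adjT m j ⟨$⟩ʳ (u ⟨$⟩ʳ i)) ⟩
        swapℕ (toℕ j) (value (adjT m j) (u ⟨$⟩ʳ i))    ≡⟨ cong (swapℕ (toℕ j)) (adjT-value j (u ⟨$⟩ʳ i)) ⟩
        swapℕ (toℕ j) (swapℕ (toℕ j) (value u i))      ≡⟨ swapℕ-involutive (toℕ j) (value u i) ⟩
        value u i                                      ∎))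
        where open ≡-Reasoning
    ... | no ¬desc = inj₁ (no-descent⇒id u (λ j → ≤∧≢⇒< (≮⇒≥ (λ q<p → ¬desc (j , q<p))) (posⱼ≢posⱼ₊₁ u j)))

  open MinPlus m

  idRank : Mat
  idRank = rankMatrix (Perm.id {m})

  rankMatrix-id-⊙ : ∀ u → (idRank ⊙ rankMatrix u) ≐ rankMatrix u
  rankMatrix-id-⊙ u p v with v ≤? m
  ... | yes v≤m = minUpTo-unique m _ (λ {k} _ → rankMatrix-∘ₚ-≤ u Perm.id p v k) v≤m
      (trans (cong (rankMatrix u p v +_) (rank-toℕ {m} {v} {v} ≤-refl)) (+-identityʳ _))
  ... | no v≰m = minUpTo-unique m _ (λ {k} _ → rankMatrix-∘ₚ-≤ u Perm.id p v k) ≤-refl (begin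
      rankMatrix u p m + idRank m v  ≡⟨ cong₂ _+_ (rankMatrix-large u p ≤-refl) (rank-toℕ {m} m≤v) ⟩
      0                                ≡⟨ sym (rankMatrix-large u p m≤v) ⟩
      rankMatrix u p v                 ∎)
    where
    open ≡-Reasoning
    m≤v = <⇒≤ (≰⇒> v≰m)

  module _ (j : Fin m′) where
    private
      jn = toℕ j

    rankMatrix-adjT-off : ∀ k v → v ≢ suc jn → rankMatrix (gen j) k v ≡ idRank k v
    rankMatrix-adjT-off k v v≢ = trans (rank-cong {g = swapℕ jn ∘ toℕ} (adjT-value j) k v) (rank-swapℕ (toℕ {m}) jn k v v≢)

    rankMatrix-adjT-on : ∀ k → rankMatrix (gen j) k (suc jn) ≡ idRank k (suc (suc jn)) + [ jn < k ]
    rankMatrix-adjT-on k = begin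
      rankMatrix (gen j) k (suc jn)
        ≡⟨ rank-cong {g = swapℕ jn ∘ toℕ} (adjT-value j) k (suc jn) ⟩
      rank {m} (swapℕ jn ∘ toℕ) k (suc jn)
        ≡⟨ rank-swapℕ-1+j (toℕ {m}) jn k ⟩
      idRank k (suc (suc jn)) + positionsBelow (value (Perm.id {m})) k jn
        ≡⟨ cong (idRank k (suc (suc jn)) +_) (positionsBelow-value (Perm.id {m}) (inject₁ j) (toℕ-inject₁ j) k) ⟩
      idRank k (suc (suc jn)) + [ toℕ (inject₁ j) < k ]
        ≡⟨ cong (λ z → idRank k (suc (suc jn)) + [ z < k ]) (toℕ-inject₁ j) ⟩
      idRank k (suc (suc jn)) + [ jn < k ] ∎
      where open ≡-Reasoning

    idRank-on : ∀ k → idRank k (suc jn) ≡ idRank k (suc (suc jn)) + [ suc jn < k ]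
    idRank-on k = trans (rank-suc-value (toℕ {m}) k (suc jn))
      (cong (idRank k (suc (suc jn)) +_) (positionsBelow-value (Perm.id {m}) (suc j) refl k))

    idRank≤adjT-on : ∀ k → idRank k (suc jn) ≤ rankMatrix (gen j) k (suc jn)
    idRank≤adjT-on k = subst₂ _≤_ (sym (idRank-on k)) (sym (rankMatrix-adjT-on k))
      (+-monoʳ-≤ (idRank k (suc (suc jn))) [suc<]≤[<])
      where
      [suc<]≤[<] : [ suc jn < k ] ≤ [ jn < k ]
      [suc<]≤[<] with suc jn <? k
      ... | no _     = z≤n
      ... | yes 1+j<k rewrite 𝟙-yes (jn <? k) (<-trans (n<1+n jn) 1+j<k) = ≤-refl

    module _ (y : Permutation′ m) where
      rankMatrix-posⱼ : ∀ p → rankMatrix y p jn ≡ rankMatrix y p (suc jn) + [ posⱼ y j < p ]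
      rankMatrix-posⱼ p = trans (rank-suc-value (value y) p jn)
        (cong (rankMatrix y p (suc jn) +_) (positionsBelow-value y (inject₁ j) (toℕ-inject₁ j) p))

      rankMatrix-posⱼ₊₁ : ∀ p → rankMatrix y p (suc jn) ≡ rankMatrix y p (suc (suc jn)) + [ posⱼ₊₁ y j < p ]
      rankMatrix-posⱼ₊₁ p = trans (rank-suc-value (value y) p (suc jn))
        (cong (rankMatrix y p (suc (suc jn)) +_) (positionsBelow-value y (suc j) refl p))

      rankMatrix-gen·-on : ∀ p → rankMatrix (gen j · y) p (suc jn) ≡ rankMatrix y p (suc (suc jn)) + [ posⱼ y j < p ]
      rankMatrix-gen·-on p = trans (rank-cong (λ a → adjT-value j (y ⟨$⟩ʳ a)) p (suc jn))
        (trans (rank-swapℕ-1+j (value y) jn p)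
          (cong (rankMatrix y p (suc (suc jn)) +_) (positionsBelow-value y (inject₁ j) (toℕ-inject₁ j) p)))

      rankMatrix-gen·-off : ∀ p v → v ≢ suc jn → rankMatrix (gen j · y) p v ≡ rankMatrix y p v
      rankMatrix-gen·-off p v v≢ = trans (rank-cong (λ a → adjT-value j (y ⟨$⟩ʳ a)) p v) (rank-swapℕ (value y) jn p v v≢)

      ⊙-adjT-off : ∀ p v → v ≢ suc jn → (rankMatrix (gen j) ⊙ rankMatrix y) p v ≡ rankMatrix y p v
      ⊙-adjT-off p v v≢ = trans (minUpTo-cong m (λ {k} _ → cong (rankMatrix y p k +_) (rankMatrix-adjT-off k v v≢)))
                                (rankMatrix-id-⊙ y p v)

      rankMatrix-≤-⊙-adjT-on : ∀ p k → rankMatrix y p (suc jn) ≤ rankMatrix y p k + rankMatrix (gen j) k (suc jn)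
      rankMatrix-≤-⊙-adjT-on p k = ≤-trans (rankMatrix-∘ₚ-≤ y Perm.id p (suc jn) k) (+-monoʳ-≤ (rankMatrix y p k) (idRank≤adjT-on k))

      -- The minimum over k is attained at k = j + 2 if x < p, and at k = j otherwise.
      ⊙-adjT-on : ∀ p {x} → x ≤ posⱼ y j → x ≤ posⱼ₊₁ y j →
        (∀ {k} → k ≤ m → rankMatrix y p (suc (suc jn)) + [ x < p ] ≤ rankMatrix y p k + rankMatrix (gen j) k (suc jn)) →
        (rankMatrix (gen j) ⊙ rankMatrix y) p (suc jn) ≡ rankMatrix y p (suc (suc jn)) + [ x < p ]
      ⊙-adjT-on p {x} x≤P x≤Q lower with x <? p
      ... | yes x<p = minUpTo-unique m _ lower 2+j≤m (begin
        rankMatrix y p (2+jn) + rankMatrix (gen j) (2+jn) (suc jn)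
          ≡⟨ cong (rankMatrix y p (2+jn) +_) (rankMatrix-adjT-on (2+jn)) ⟩
        rankMatrix y p (2+jn) + (idRank (2+jn) (2+jn) + [ jn < 2+jn ])
          ≡⟨ cong (λ z → rankMatrix y p (2+jn) + (z + [ jn < 2+jn ])) (rank-toℕ {m} {2+jn} ≤-refl) ⟩
        rankMatrix y p (2+jn) + [ jn < 2+jn ]
          ≡⟨ cong (rankMatrix y p (2+jn) +_) (𝟙-yes (jn <? 2+jn) (m<n⇒m<1+n (n<1+n jn))) ⟩
        rankMatrix y p (2+jn) + 1 ∎)
        where
        open ≡-Reasoning
        2+jn = suc (suc jn)
        2+j≤m = s≤s (toℕ<n j)
      ... | no x≮p = minUpTo-unique m _ lower j≤m (begin
        rankMatrix y p jn + rankMatrix (gen j) jn (suc jn)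
          ≡⟨ cong (rankMatrix y p jn +_) (rankMatrix-adjT-on jn) ⟩
        rankMatrix y p jn + (idRank jn (2+jn) + [ jn < jn ])
          ≡⟨ cong₂ (λ z w → rankMatrix y p jn + (z + w)) (rank-toℕ {m} {jn} (m≤n+m jn 2)) ([<]-irrefl jn) ⟩
        rankMatrix y p jn + 0
          ≡⟨ +-identityʳ _ ⟩
        rankMatrix y p jn
          ≡⟨ rankMatrix-posⱼ p ⟩
        rankMatrix y p (suc jn) + [ posⱼ y j < p ]
          ≡⟨ cong (_+ [ posⱼ y j < p ]) (rankMatrix-posⱼ₊₁ p) ⟩
        rankMatrix y p (2+jn) + [ posⱼ₊₁ y j < p ] + [ posⱼ y j < p ]
          ≡⟨ cong₂ (λ z w → rankMatrix y p (2+jn) + z + w) (not-before x≤Q) (not-before x≤P) ⟩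
        rankMatrix y p (2+jn) + 0 + 0
          ≡⟨ +-identityʳ _ ⟩
        rankMatrix y p (2+jn) + 0 ∎)
        where
        open ≡-Reasoning
        2+jn = suc (suc jn)
        j≤m = ≤-trans (n≤1+n jn) (<⇒≤ (s≤s (toℕ<n j)))
        not-before : ∀ {z} → x ≤ z → [ z < p ] ≡ 0
        not-before x≤z = 𝟙-no (_ <? p) (λ z<p → x≮p (≤-<-trans x≤z z<p))

  rankMatrix-gen·-ascent : ∀ j y → Ascent y j → rankMatrix (gen j · y) ≐ (rankMatrix (gen j) ⊙ rankMatrix y)
  rankMatrix-gen·-ascent j y asc p v with v ≟ suc (toℕ j)
  ... | no v≢ = trans (rankMatrix-gen·-off j y p v v≢) (sym (⊙-adjT-off j y p v v≢))
  ... | yes refl = trans (rankMatrix-gen·-on j y p) (sym (⊙-adjT-on j y p ≤-refl (<⇒≤ asc) (λ {k} _ →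
    subst (_≤ rankMatrix y p k + rankMatrix (gen j) k v) (rankMatrix-gen·-on j y p) (rankMatrix-∘ₚ-≤ y (gen j) p v k))))

  rankMatrix-descent : ∀ j y → Descent y j → rankMatrix y ≐ (rankMatrix (gen j) ⊙ rankMatrix y)
  rankMatrix-descent j y desc p v with v ≟ suc (toℕ j)
  ... | no v≢ = sym (⊙-adjT-off j y p v v≢)
  ... | yes refl = trans (rankMatrix-posⱼ₊₁ j y p) (sym (⊙-adjT-on j y p (<⇒≤ desc) ≤-refl (λ {k} _ →
    subst (_≤ rankMatrix y p k + rankMatrix (gen j) k v) (rankMatrix-posⱼ₊₁ j y p) (rankMatrix-≤-⊙-adjT-on j y p k))))

  rankMatrix-⋆gen : ∀ j y → rankMatrix (j ⋆gen y) ≐ (rankMatrix (gen j) ⊙ rankMatrix y)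
  rankMatrix-⋆gen j y with posⱼ y j <? posⱼ₊₁ y j
  ... | yes asc = ≐-trans (λ p v → cong (λ z → rankMatrix z p v) (⋆gen-ascent inversionLength j y (inversions-ascent j y asc)))
                          (rankMatrix-gen·-ascent j y asc)
  ... | no ¬asc = ≐-trans (λ p v → cong (λ z → rankMatrix z p v) (⋆gen-descent inversionLength j y (inversions-descent j y desc)))
                          (rankMatrix-descent j y desc)
    where desc = ¬Ascent⇒Descent y j ¬asc

  rankMatrix-⋆ : ∀ x u → rankMatrix (x ⋆ u) ≐ (rankMatrix x ⊙ rankMatrix u)
  rankMatrix-⋆ = ⋆-homomorphism inversionLength minPlusSemigroup rankMatrix (rankMatrix ∘ gen)
    (λ {π} {σ} → rankMatrix-cong {m} {π} {σ}) (λ u → ≐-sym (rankMatrix-id-⊙ u)) rankMatrix-⋆gen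

  gen·-position : ∀ t y c → toℕ c ≢ toℕ t → toℕ c ≢ suc (toℕ t) → (gen t · y) ⟨$⟩ˡ c ≡ y ⟨$⟩ˡ c
  gen·-position t y c c≢t c≢1+t = begin
    (gen t · y) ⟨$⟩ˡ c                                 ≡⟨ cong ((gen t · y) ⟨$⟩ˡ_) (sym c-fixed) ⟩
    (gen t · y) ⟨$⟩ˡ ((gen t · y) ⟨$⟩ʳ (y ⟨$⟩ˡ c))     ≡⟨ inverseˡ (gen t · y) ⟩
    y ⟨$⟩ˡ c                                           ∎
    where
    open ≡-Reasoning
    c-fixed : (gen t · y) ⟨$⟩ʳ (y ⟨$⟩ˡ c) ≡ c
    c-fixed = toℕ-injective (begin
      value (gen t) (y ⟨$⟩ʳ (y ⟨$⟩ˡ c))     ≡⟨ adjT-value t (y ⟨$⟩ʳ (y ⟨$⟩ˡ c)) ⟩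
      swapℕ (toℕ t) (value y (y ⟨$⟩ˡ c))    ≡⟨ cong (swapℕ (toℕ t) ∘ toℕ) (inverseʳ y) ⟩
      swapℕ (toℕ t) (toℕ c)                 ≡⟨ swapℕ-other (toℕ t) (toℕ c) c≢t c≢1+t ⟩
      toℕ c                                 ∎)

module Hyperoctahedral (k : ℕ) where
  n m′ : ℕ
  n  = suc k
  m′ = k + suc k

  open SymmetricGroup m′
  open FinGroupGens (Sym (n + n)) using (gen; _·_)

  enc : ±Fin n → ℕ
  enc x = toℕ (encode x)

  enc-pos : ∀ a → enc (pos a) ≡ toℕ a
  enc-pos a = toℕ-↑ˡ a n

  enc-neg : ∀ a → enc (neg a) + toℕ a ≡ m′
  enc-neg a = begin
    enc (neg a) + toℕ a               ≡⟨ cong (_+ toℕ a) (toℕ-↑ʳ n (opposite a)) ⟩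
    n + toℕ (opposite a) + toℕ a      ≡⟨ +-assoc n _ _ ⟩
    n + (toℕ (opposite a) + toℕ a)    ≡⟨ cong (λ z → n + (z + toℕ a)) (opposite-prop a) ⟩
    n + (k ∸ toℕ a + toℕ a)           ≡⟨ cong (n +_) (m∸n+n≡m (≤-pred (toℕ<n a))) ⟩
    n + k                             ≡⟨ +-comm n k ⟩
    m′                                ∎
    where open ≡-Reasoning

  enc-negate : ∀ x → enc (negate x) + enc x ≡ m′
  enc-negate (pos a) = trans (cong (enc (neg a) +_) (enc-pos a)) (enc-neg a)
  enc-negate (neg a) = trans (cong (_+ enc (neg a)) (enc-pos a)) (trans (+-comm (toℕ a) _) (enc-neg a))

  n≤enc-neg : ∀ a → n ≤ enc (neg a)
  n≤enc-neg a = subst (n ≤_) (sym (toℕ-↑ʳ n (opposite a))) (m≤m+n n _)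

  encode-injective : ∀ {x y : ±Fin n} → encode x ≡ encode y → x ≡ y
  encode-injective {x} {y} eq = trans (sym (decode-encode x)) (trans (cong decode eq) (decode-encode y))

  mirror : Fin (n + n) → Fin (n + n)
  mirror i = encode (negate (decode {n} i))

  mirror-sum : ∀ i → toℕ (mirror i) + toℕ i ≡ m′
  mirror-sum i = trans (cong (λ z → toℕ (mirror i) + toℕ z) (sym (encode-decode {n} i))) (enc-negate (decode {n} i))

  mirror-unique : ∀ c d → toℕ c + toℕ d ≡ m′ → mirror d ≡ c
  mirror-unique c d c+d≡m′ = toℕ-injective (+-cancelʳ-≡ (toℕ d) (toℕ (mirror d)) (toℕ c) (trans (mirror-sum d) (sym c+d≡m′)))

  ι-mirror : ∀ (X : SignedPerm n) i → ι X ⟨$⟩ʳ mirror i ≡ mirror (ι X ⟨$⟩ʳ i)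
  ι-mirror X i = begin
    ι X ⟨$⟩ʳ mirror i                                      ≡⟨ cong (encode ∘ fun X) (decode-encode (negate (decode i))) ⟩
    encode (fun X (negate (decode i)))                     ≡⟨ cong encode (odd X (decode i)) ⟩
    encode (negate (fun X (decode i)))                     ≡⟨ cong (encode ∘ negate) (sym (decode-encode (fun X (decode i)))) ⟩
    mirror (ι X ⟨$⟩ʳ i)                                    ∎
    where open ≡-Reasoning

  ι⁻¹-mirror : ∀ (X : SignedPerm n) c → ι X ⟨$⟩ˡ mirror c ≡ mirror (ι X ⟨$⟩ˡ c)
  ι⁻¹-mirror X c = begin
    ι X ⟨$⟩ˡ mirror c                                     ≡⟨ cong (λ z → ι X ⟨$⟩ˡ mirror z) (sym (inverseʳ (ι X) {c})) ⟩
    ι X ⟨$⟩ˡ mirror (ι X ⟨$⟩ʳ (ι X ⟨$⟩ˡ c))               ≡⟨ cong (ι X ⟨$⟩ˡ_) (sym (ι-mirror X (ι X ⟨$⟩ˡ c))) ⟩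
    ι X ⟨$⟩ˡ (ι X ⟨$⟩ʳ mirror (ι X ⟨$⟩ˡ c))               ≡⟨ inverseˡ (ι X) ⟩
    mirror (ι X ⟨$⟩ˡ c)                                   ∎
    where open ≡-Reasoning

  positions-mirror : ∀ (X : SignedPerm n) c d → toℕ c + toℕ d ≡ m′ → toℕ (ι X ⟨$⟩ˡ c) + toℕ (ι X ⟨$⟩ˡ d) ≡ m′
  positions-mirror X c d c+d≡m′ = begin
    toℕ (ι X ⟨$⟩ˡ c) + toℕ (ι X ⟨$⟩ˡ d)
      ≡⟨ cong (λ z → toℕ (ι X ⟨$⟩ˡ z) + toℕ (ι X ⟨$⟩ˡ d)) (sym (mirror-unique c d c+d≡m′)) ⟩
    toℕ (ι X ⟨$⟩ˡ mirror d) + toℕ (ι X ⟨$⟩ˡ d)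
      ≡⟨ cong (λ z → toℕ z + toℕ (ι X ⟨$⟩ˡ d)) (ι⁻¹-mirror X d) ⟩
    toℕ (mirror (ι X ⟨$⟩ˡ d)) + toℕ (ι X ⟨$⟩ˡ d)
      ≡⟨ mirror-sum (ι X ⟨$⟩ˡ d) ⟩
    m′ ∎
    where open ≡-Reasoning

  k<mirror-index : ∀ {c t′} → c < k → c + t′ ≡ k + k → k < t′
  k<mirror-index {c} {t′} c<k c+t′≡2k = +-cancelˡ-< k k t′ (subst (_< k + t′) c+t′≡2k (+-monoˡ-< t′ c<k))

  suc-sum≡m′ : ∀ {c t′} → c + t′ ≡ k + k → suc (c + t′) ≡ m′
  suc-sum≡m′ c+t′≡2k = trans (cong suc c+t′≡2k) (sym (+-suc k k))

  -- ι sⱼ = s′ⱼ s′₂ₙ₋ⱼ for j < n and ι sₙ = s′ₙ.  Indices are 0-based here: a pair has t = j and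
  -- t + t′ = 2k, a single has t = k.
  data GenUnfolding (j : Fin n) (g : SignedPerm n) : Set where
    pair   : (t t′ : Fin m′) → toℕ t ≡ toℕ j → toℕ t + toℕ t′ ≡ k + k → toℕ t < k →
             (∀ x → enc (fun g x) ≡ swapℕ (toℕ t) (swapℕ (toℕ t′) (enc x))) → GenUnfolding j g
    single : (t : Fin m′) → toℕ t ≡ toℕ j → toℕ t ≡ k →
             (∀ x → enc (fun g x) ≡ swapℕ (toℕ t) (enc x)) → GenUnfolding j g

  private
    liftB-adjT-action : ∀ (c : Fin k) t′ → toℕ c + t′ ≡ k + k → ∀ x →
      enc (fun (liftB (adjT n c)) x) ≡ swapℕ (toℕ c) (swapℕ t′ (enc x))
    liftB-adjT-action c t′ c+t′≡2k (pos a) = begin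
      enc (pos (τ ⟨$⟩ʳ a))                     ≡⟨ enc-pos (τ ⟨$⟩ʳ a) ⟩
      value τ a                                ≡⟨ adjT-value c a ⟩
      swapℕ (toℕ c) (toℕ a)                    ≡⟨ cong (swapℕ (toℕ c)) (sym (swapℕ-below t′ (toℕ a) a<t′)) ⟩
      swapℕ (toℕ c) (swapℕ t′ (toℕ a))         ≡⟨ cong (swapℕ (toℕ c) ∘ swapℕ t′) (sym (enc-pos a)) ⟩
      swapℕ (toℕ c) (swapℕ t′ (enc (pos a)))   ∎
      where
      open ≡-Reasoning
      τ = adjT n c
      a<t′ : toℕ a < t′
      a<t′ = ≤-<-trans (≤-pred (toℕ<n a)) (k<mirror-index (toℕ<n c) c+t′≡2k)
    liftB-adjT-action c t′ c+t′≡2k (neg a) = begin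
      enc (neg (τ ⟨$⟩ʳ a))                     ≡⟨ mirrored ⟩
      swapℕ t′ (enc (neg a))                   ≡⟨ sym (swapℕ-above (toℕ c) _ 1+c<neg) ⟩
      swapℕ (toℕ c) (swapℕ t′ (enc (neg a)))   ∎
      where
      open ≡-Reasoning
      τ = adjT n c
      mirrored : enc (neg (τ ⟨$⟩ʳ a)) ≡ swapℕ t′ (enc (neg a))
      mirrored = +-cancelʳ-≡ (swapℕ (toℕ c) (toℕ a)) _ _ (trans
        (subst (λ z → enc (neg (τ ⟨$⟩ʳ a)) + z ≡ m′) (adjT-value c a) (enc-neg (τ ⟨$⟩ʳ a)))
        (sym (swapℕ-mirror (toℕ c) t′ (enc (neg a)) (toℕ a) (suc-sum≡m′ {toℕ c} {t′} c+t′≡2k) (enc-neg a))))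
      1+c<neg : suc (toℕ c) < swapℕ t′ (enc (neg a))
      1+c<neg = <-≤-trans (s≤s (toℕ<n c)) (subst (n ≤_) mirrored (n≤enc-neg (τ ⟨$⟩ʳ a)))

    enc-neg-last : ∀ a → toℕ a ≡ k → enc (neg a) ≡ suc k
    enc-neg-last a a≡k = +-cancelʳ-≡ k (enc (neg a)) (suc k)
      (trans (subst (λ z → enc (neg a) + z ≡ m′) a≡k (enc-neg a)) (+-comm k (suc k)))

    <k-unless-last : ∀ {a : Fin n} → a ≢ fromℕ k → toℕ a < k
    <k-unless-last {a} a≢k = ≤∧≢⇒< (≤-pred (toℕ<n a)) (λ a≡k → a≢k (toℕ-injective (trans a≡k (sym (toℕ-fromℕ k)))))

    flipLast-action : ∀ x → enc (flipLastFun k x) ≡ swapℕ k (enc x)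
    flipLast-action (pos a) with a Fin.≟ fromℕ k
    ... | yes refl = begin
      enc (neg (fromℕ k))             ≡⟨ enc-neg-last (fromℕ k) (toℕ-fromℕ k) ⟩
      suc k                           ≡⟨ sym (swapℕ-j k) ⟩
      swapℕ k k                       ≡⟨ cong (swapℕ k) (sym (trans (enc-pos (fromℕ k)) (toℕ-fromℕ k))) ⟩
      swapℕ k (enc (pos (fromℕ k)))   ∎
      where open ≡-Reasoning
    ... | no a≢k = trans (enc-pos a) (sym (trans (cong (swapℕ k) (enc-pos a)) (swapℕ-below k (toℕ a) (<k-unless-last a≢k))))
    flipLast-action (neg a) with a Fin.≟ fromℕ k
    ... | yes refl = begin
      enc (pos (fromℕ k))             ≡⟨ trans (enc-pos (fromℕ k)) (toℕ-fromℕ k) ⟩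
      k                               ≡⟨ sym (swapℕ-1+j k) ⟩
      swapℕ k (suc k)                 ≡⟨ cong (swapℕ k) (sym (enc-neg-last (fromℕ k) (toℕ-fromℕ k))) ⟩
      swapℕ k (enc (neg (fromℕ k)))   ∎
      where open ≡-Reasoning
    ... | no a≢k = sym (swapℕ-above k (enc (neg a)) 1+k<neg)
      where
      a<k = <k-unless-last a≢k
      1+k<neg : suc k < enc (neg a)
      1+k<neg = +-cancelʳ-< (toℕ a) (suc k) (enc (neg a))
        (subst (suc k + toℕ a <_) (sym (enc-neg a)) (subst (suc (k + toℕ a) <_) (sym (+-suc k k)) (s≤s (+-monoʳ-< k a<k))))

  genUnfolding : ∀ j → GenUnfolding j (genB n j)
  genUnfolding j with toℕ j <? k
  ... | yes j<k = pair t t′ (toℕ-fromℕ< j<m′) t+t′≡2k (subst (_< k) (sym (toℕ-fromℕ< j<m′)) j<k) action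
    where
    c = fromℕ< j<k
    j<m′ : toℕ j < m′
    j<m′ = <-≤-trans j<k (m≤m+n k (suc k))
    t′n = (k + k) ∸ toℕ j
    t′<m′ : t′n < m′
    t′<m′ = subst (t′n <_) (sym (+-suc k k)) (s≤s (m∸n≤m (k + k) (toℕ j)))
    t t′ : Fin m′
    t  = fromℕ< j<m′
    t′ = fromℕ< t′<m′
    j+t′≡2k : toℕ j + t′n ≡ k + k
    j+t′≡2k = m+[n∸m]≡n (≤-trans (<⇒≤ j<k) (m≤m+n k k))
    t+t′≡2k : toℕ t + toℕ t′ ≡ k + k
    t+t′≡2k = trans (cong₂ _+_ (toℕ-fromℕ< j<m′) (toℕ-fromℕ< t′<m′)) j+t′≡2k
    action : ∀ x → enc (fun (liftB (adjT n c)) x) ≡ swapℕ (toℕ t) (swapℕ (toℕ t′) (enc x))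
    action x = trans (liftB-adjT-action c t′n (subst (λ z → z + t′n ≡ k + k) (sym (toℕ-fromℕ< j<k)) j+t′≡2k) x)
      (cong₂ (λ a b → swapℕ a (swapℕ b (enc x)))
        (trans (toℕ-fromℕ< j<k) (sym (toℕ-fromℕ< j<m′))) (sym (toℕ-fromℕ< t′<m′)))
  ... | no j≮k = single t (trans (toℕ-fromℕ< k<m′) (sym j≡k)) (toℕ-fromℕ< k<m′)
      (λ x → subst (λ z → enc (flipLastFun k x) ≡ swapℕ z (enc x)) (sym (toℕ-fromℕ< k<m′)) (flipLast-action x))
    where
    j≡k : toℕ j ≡ k
    j≡k = ≤-antisym (≤-pred (toℕ<n j)) (≮⇒≥ j≮k)
    k<m′ : k < m′
    k<m′ = m≤n+m (suc k) k
    t = fromℕ< k<m′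

  ι-cong : ∀ {X X′ : SignedPerm n} → X ≈B X′ → ι X Perm.≈ ι X′
  ι-cong X≈X′ i = cong encode (X≈X′ (decode {n} i))

  ι-idB : ι (idB {n}) Perm.≈ Perm.id
  ι-idB = encode-decode {n}

  ι-·B-pair : ∀ g (t t′ : Fin m′) → (∀ x → enc (fun g x) ≡ swapℕ (toℕ t) (swapℕ (toℕ t′) (enc x))) →
    ∀ X → ι (g ·B X) Perm.≈ (gen t · (gen t′ · ι X))
  ι-·B-pair g t t′ action X i = toℕ-injective (begin
    enc (fun g (fun X (decode i)))                  ≡⟨ action (fun X (decode i)) ⟩
    swapℕ (toℕ t) (swapℕ (toℕ t′) (value (ι X) i))  ≡⟨ cong (swapℕ (toℕ t)) (sym (adjT-value t′ (ι X ⟨$⟩ʳ i))) ⟩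
    swapℕ (toℕ t) (value (gen t′) (ι X ⟨$⟩ʳ i))     ≡⟨ sym (adjT-value t (gen t′ ⟨$⟩ʳ (ι X ⟨$⟩ʳ i))) ⟩
    value (gen t · (gen t′ · ι X)) i                ∎)
    where open ≡-Reasoning

  ι-·B-single : ∀ g (t : Fin m′) → (∀ x → enc (fun g x) ≡ swapℕ (toℕ t) (enc x)) →
    ∀ X → ι (g ·B X) Perm.≈ (gen t · ι X)
  ι-·B-single g t action X i = toℕ-injective (trans (action (fun X (decode i))) (sym (adjT-value t (ι X ⟨$⟩ʳ i))))

  weight : Permutation′ (n + n) → ℕ
  weight Y = inversions Y + rankMatrix Y n n

  weight-cong : ∀ {Y Z} → Y Perm.≈ Z → weight Y ≡ weight Z
  weight-cong {Y} {Z} Y≈Z = cong₂ _+_ (inversions-cong {_} {Y} {Z} Y≈Z) (rankMatrix-cong {_} {Y} {Z} Y≈Z n n)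

  -- rankMatrix (ι X) n n counts the i ∈ [n] with X(i) < 0.
  lengthB : SignedPerm n → ℕ
  lengthB X = ⌊ weight (ι X) /2⌋

  -- s′_t and s′_t′ move disjoint values, and by the mirror symmetry of ι X they are ascents together.
  module PairStep (t t′ : Fin m′) (t+t′≡2k : toℕ t + toℕ t′ ≡ k + k) (t<k : toℕ t < k) (X : SignedPerm n) where
    private
      Y = ι X
      k<t′ = k<mirror-index t<k t+t′≡2k
      1+t′+t≡m′ : suc (toℕ t′ + toℕ t) ≡ m′
      1+t′+t≡m′ = trans (cong suc (+-comm (toℕ t′) (toℕ t))) (suc-sum≡m′ {toℕ t} {toℕ t′} t+t′≡2k)
      mirror₁ : posⱼ Y t′ + posⱼ₊₁ Y t ≡ m′
      mirror₁ = positions-mirror X (inject₁ t′) (suc t)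
        (trans (cong (_+ suc (toℕ t)) (toℕ-inject₁ t′)) (trans (+-suc (toℕ t′) (toℕ t)) 1+t′+t≡m′))
      mirror₂ : posⱼ₊₁ Y t′ + posⱼ Y t ≡ m′
      mirror₂ = positions-mirror X (suc t′) (inject₁ t) (trans (cong (suc (toℕ t′) +_) (toℕ-inject₁ t)) 1+t′+t≡m′)

    ascent-mirror : Ascent Y t → Ascent Y t′
    ascent-mirror = +-mirror-< (trans mirror₁ (sym mirror₂))

    descent-mirror : Descent Y t → Descent Y t′
    descent-mirror = +-mirror-< (trans mirror₂ (sym mirror₁))

    private
      t+2≤t′ : suc (suc (toℕ t)) ≤ toℕ t′
      t+2≤t′ = ≤-trans (s≤s t<k) k<t′
      posⱼ-unmoved : posⱼ (gen t′ · Y) t ≡ posⱼ Y t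
      posⱼ-unmoved = cong toℕ (gen·-position t′ Y (inject₁ t)
        (λ eq → <⇒≢ (≤-trans (n≤1+n _) t+2≤t′) (trans (sym (toℕ-inject₁ t)) eq))
        (λ eq → <⇒≢ (≤-trans (n≤1+n _) (m≤n⇒m≤1+n t+2≤t′)) (trans (sym (toℕ-inject₁ t)) eq)))
      posⱼ₊₁-unmoved : posⱼ₊₁ (gen t′ · Y) t ≡ posⱼ₊₁ Y t
      posⱼ₊₁-unmoved = cong toℕ (gen·-position t′ Y (suc t) (<⇒≢ t+2≤t′) (<⇒≢ (m≤n⇒m≤1+n t+2≤t′)))
      rank-unmoved : rankMatrix (gen t · (gen t′ · Y)) n n ≡ rankMatrix Y n n
      rank-unmoved = trans (rankMatrix-gen·-off t (gen t′ · Y) n n (≢-sym (<⇒≢ (s≤s t<k))))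
                           (rankMatrix-gen·-off t′ Y n n (<⇒≢ (s≤s k<t′)))

    ascent-unmoved : Ascent Y t → Ascent (gen t′ · Y) t
    ascent-unmoved = subst₂ _<_ (sym posⱼ-unmoved) (sym posⱼ₊₁-unmoved)

    descent-unmoved : Descent Y t → Descent (gen t′ · Y) t
    descent-unmoved = subst₂ _<_ (sym posⱼ₊₁-unmoved) (sym posⱼ-unmoved)

    weight-ascent : Ascent Y t → weight (gen t · (gen t′ · Y)) ≡ suc (suc (weight Y))
    weight-ascent asc = cong₂ _+_
      (trans (inversions-ascent t (gen t′ · Y) (ascent-unmoved asc)) (cong suc (inversions-ascent t′ Y (ascent-mirror asc))))
      rank-unmoved

    weight-descent : Descent Y t → suc (suc (weight (gen t · (gen t′ · Y)))) ≡ weight Y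
    weight-descent desc = cong₂ _+_
      (trans (cong suc (inversions-descent t (gen t′ · Y) (descent-unmoved desc)))
             (inversions-descent t′ Y (descent-mirror desc)))
      rank-unmoved

  -- The positions of k and k + 1 in ι X are mirror images, hence lie on either side of n, so an
  -- ascent at k also turns one positive value negative.
  module SingleStep (t : Fin m′) (t≡k : toℕ t ≡ k) (X : SignedPerm n) where
    private
      Y = ι X
      mirrored : posⱼ₊₁ Y t + posⱼ Y t ≡ m′
      mirrored = positions-mirror X (suc t) (inject₁ t)
        (trans (cong₂ (λ a b → suc a + b) t≡k (trans (toℕ-inject₁ t) t≡k)) (+-comm n k))
      straddle : ∀ {p q} → q + p ≡ m′ → p < q → p < n × n ≤ q
      straddle {p} {q} q+p≡m′ p<q = p<n , n≤q
        where
        p<n : p < n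
        p<n = ≰⇒> (λ n≤p → <-irrefl (sym q+p≡m′) (subst (_< q + p) (+-comm n k)
                (+-mono-<-≤ (<-≤-trans (n<1+n n) (<-≤-trans (s≤s n≤p) p<q)) (≤-trans (n≤1+n k) n≤p))))
        n≤q : n ≤ q
        n≤q = ≮⇒≥ (λ q<n → <-irrefl q+p≡m′
                (<-≤-trans (+-mono-≤-< (≤-pred q<n) (<-≤-trans p<q (≤-pred q<n))) (+-monoʳ-≤ k (n≤1+n k))))
      R = rankMatrix Y n (suc n)
      rank-after : ∀ {z} → [ posⱼ Y t < n ] ≡ z → rankMatrix (gen t · Y) n n ≡ R + z
      rank-after {z} eq = trans (subst (λ x → rankMatrix (gen t · Y) n (suc x) ≡ rankMatrix Y n (suc (suc x)) + [ posⱼ Y t < n ]) t≡k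
        (rankMatrix-gen·-on t Y n)) (cong (R +_) eq)
      rank-before : ∀ {z} → [ posⱼ₊₁ Y t < n ] ≡ z → rankMatrix Y n n ≡ R + z
      rank-before eq = trans (subst (λ x → rankMatrix Y n (suc x) ≡ rankMatrix Y n (suc (suc x)) + [ posⱼ₊₁ Y t < n ]) t≡k
        (rankMatrix-posⱼ₊₁ t Y n)) (cong (R +_) eq)

    weight-ascent : Ascent Y t → weight (gen t · Y) ≡ suc (suc (weight Y))
    weight-ascent asc = begin
      inversions (gen t · Y) + rankMatrix (gen t · Y) n n   ≡⟨ cong₂ _+_ (inversions-ascent t Y asc) (rank-after (𝟙-yes (_ <? n) p<n)) ⟩
      suc (inversions Y) + (R + 1)                          ≡⟨ cong (suc (inversions Y) +_) (+-comm R 1) ⟩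
      suc (inversions Y) + suc R                            ≡⟨ cong suc (+-suc (inversions Y) R) ⟩
      suc (suc (inversions Y + R))                          ≡⟨ cong (λ z → suc (suc (inversions Y + z))) (sym R≡) ⟩
      suc (suc (inversions Y + rankMatrix Y n n))           ∎
      where
      open ≡-Reasoning
      straddled = straddle mirrored asc
      p<n = proj₁ straddled
      R≡ : rankMatrix Y n n ≡ R
      R≡ = trans (rank-before (𝟙-no (_ <? n) (≤⇒≯ (proj₂ straddled)))) (+-identityʳ R)

    weight-descent : Descent Y t → suc (suc (weight (gen t · Y))) ≡ weight Y
    weight-descent desc = begin
      suc (suc (inversions (gen t · Y) + rankMatrix (gen t · Y) n n)) ≡⟨ cong (λ z → suc (suc (inversions (gen t · Y) + z))) R≡ ⟩
      suc (suc (inversions (gen t · Y) + R))                          ≡⟨ cong suc (sym (+-suc (inversions (gen t · Y)) R)) ⟩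
      suc (inversions (gen t · Y)) + suc R                            ≡⟨ cong₂ _+_ (inversions-descent t Y desc) (+-comm 1 R) ⟩
      inversions Y + (R + 1)                                          ≡⟨ cong (inversions Y +_) (sym (rank-before (𝟙-yes (_ <? n) q<n))) ⟩
      inversions Y + rankMatrix Y n n                                 ∎
      where
      open ≡-Reasoning
      straddled = straddle (trans (+-comm (posⱼ Y t) (posⱼ₊₁ Y t)) mirrored) desc
      q<n = proj₁ straddled
      R≡ : rankMatrix (gen t · Y) n n ≡ R
      R≡ = trans (rank-after (𝟙-no (_ <? n) (≤⇒≯ (proj₂ straddled)))) (+-identityʳ R)

  testIndex : ∀ {j g} → GenUnfolding j g → Fin m′
  testIndex (pair t _ _ _ _ _) = t
  testIndex (single t _ _ _)   = t

  unfolded : ∀ {j g} → GenUnfolding j g → Permutation′ (n + n) → Permutation′ (n + n)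
  unfolded (pair t t′ _ _ _ _) Y = gen t · (gen t′ · Y)
  unfolded (single t _ _ _)    Y = gen t · Y

  ι-·B : ∀ {j g} (u : GenUnfolding j g) (X : SignedPerm n) → ι (g ·B X) Perm.≈ unfolded u (ι X)
  ι-·B {g = g} (pair t t′ _ _ _ action) = ι-·B-pair g t t′ action
  ι-·B {g = g} (single t _ _ action)    = ι-·B-single g t action

  weight-unfolded-ascent : ∀ {j g} (u : GenUnfolding j g) (X : SignedPerm n) →
    Ascent (ι X) (testIndex u) → weight (unfolded u (ι X)) ≡ suc (suc (weight (ι X)))
  weight-unfolded-ascent (pair t t′ _ t+t′≡2k t<k _) X = PairStep.weight-ascent t t′ t+t′≡2k t<k X
  weight-unfolded-ascent (single t _ t≡k _)           X = SingleStep.weight-ascent t t≡k X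

  weight-unfolded-descent : ∀ {j g} (u : GenUnfolding j g) (X : SignedPerm n) →
    Descent (ι X) (testIndex u) → suc (suc (weight (unfolded u (ι X)))) ≡ weight (ι X)
  weight-unfolded-descent (pair t t′ _ t+t′≡2k t<k _) X = PairStep.weight-descent t t′ t+t′≡2k t<k X
  weight-unfolded-descent (single t _ t≡k _)           X = SingleStep.weight-descent t t≡k X

  lengthB-ascent : ∀ {j g} (u : GenUnfolding j g) (X : SignedPerm n) →
    Ascent (ι X) (testIndex u) → lengthB (g ·B X) ≡ suc (lengthB X)
  lengthB-ascent {g = g} u X asc = cong ⌊_/2⌋
    (trans (weight-cong {ι (g ·B X)} {unfolded u (ι X)} (ι-·B u X)) (weight-unfolded-ascent u X asc))

  lengthB-descent : ∀ {j g} (u : GenUnfolding j g) (X : SignedPerm n) →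
    Descent (ι X) (testIndex u) → suc (lengthB (g ·B X)) ≡ lengthB X
  lengthB-descent {g = g} u X desc = cong ⌊_/2⌋
    (trans (cong (λ w → suc (suc w)) (weight-cong {ι (g ·B X)} {unfolded u (ι X)} (ι-·B u X)))
           (weight-unfolded-descent u X desc))

  gen-involutive : ∀ {j g} → GenUnfolding j g → ∀ x → fun g (fun g x) ≡ x
  gen-involutive {g = g} (pair t t′ _ t+t′≡2k t<k action) x = encode-injective (toℕ-injective (begin
    enc (fun g (fun g x))                                        ≡⟨ action (fun g x) ⟩
    s t (s t′ (enc (fun g x)))                                   ≡⟨ cong (s t ∘ s t′) (action x) ⟩
    s t (s t′ (s t (s t′ (enc x))))                              ≡⟨ cong (s t) (sym (swapℕ-comm (toℕ t) (toℕ t′) (s t′ (enc x)) 1+t<t′)) ⟩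
    s t (s t (s t′ (s t′ (enc x))))                              ≡⟨ swapℕ-involutive (toℕ t) _ ⟩
    s t′ (s t′ (enc x))                                          ≡⟨ swapℕ-involutive (toℕ t′) (enc x) ⟩
    enc x                                                        ∎))
    where
    open ≡-Reasoning
    s = swapℕ ∘ toℕ
    1+t<t′ = ≤-trans (s≤s t<k) (k<mirror-index t<k t+t′≡2k)
  gen-involutive {g = g} (single t _ _ action) x = encode-injective (toℕ-injective (begin
    enc (fun g (fun g x))                  ≡⟨ action (fun g x) ⟩
    swapℕ (toℕ t) (enc (fun g x))          ≡⟨ cong (swapℕ (toℕ t)) (action x) ⟩
    swapℕ (toℕ t) (swapℕ (toℕ t) (enc x))  ≡⟨ swapℕ-involutive (toℕ t) (enc x) ⟩
    enc x                                  ∎))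
    where open ≡-Reasoning

  Covers : ∀ {j g} → GenUnfolding j g → Fin m′ → Set
  Covers (pair t t′ _ _ _ _) s = toℕ s ≡ toℕ t ⊎ toℕ s ≡ toℕ t′
  Covers (single t _ _ _)    s = toℕ s ≡ toℕ t

  covers-same : ∀ {j g} (u : GenUnfolding j g) s → toℕ s ≡ toℕ j → Covers u s
  covers-same (pair _ _ t≡j _ _ _) s s≡j = inj₁ (trans s≡j (sym t≡j))
  covers-same (single _ t≡j _ _)   s s≡j = trans s≡j (sym t≡j)

  covers-mirror : ∀ {j g} (u : GenUnfolding j g) s → toℕ j < k → toℕ j + toℕ s ≡ k + k → Covers u s
  covers-mirror (pair t t′ t≡j t+t′≡2k _ _) s _ j+s≡2k =
    inj₂ (+-cancelˡ-≡ (toℕ t) (toℕ s) (toℕ t′) (trans (subst (λ z → z + toℕ s ≡ k + k) (sym t≡j) j+s≡2k) (sym t+t′≡2k)))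
  covers-mirror (single t t≡j t≡k _) s j<k _ = ⊥-elim (<-irrefl (trans (sym t≡j) t≡k) j<k)

  every-index-covered : ∀ s → Σ[ j ∈ Fin n ] Covers (genUnfolding j) s
  every-index-covered s with toℕ s ≤? k
  ... | yes s≤k = fromℕ< (s≤s s≤k) , covers-same (genUnfolding _) s (sym (toℕ-fromℕ< (s≤s s≤k)))
  ... | no s≰k = fromℕ< r<n , covers-mirror (genUnfolding _) s (subst (_< k) (sym (toℕ-fromℕ< r<n)) r<k)
                  (trans (cong (_+ toℕ s) (toℕ-fromℕ< r<n)) (m∸n+n≡m s≤2k))
    where
    s≤2k : toℕ s ≤ k + k
    s≤2k = ≤-pred (subst (toℕ s <_) (+-suc k k) (toℕ<n s))
    r = (k + k) ∸ toℕ s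
    r<k : r < k
    r<k = +-cancelʳ-< (toℕ s) r k (subst (_< k + toℕ s) (sym (m∸n+n≡m s≤2k)) (+-monoʳ-< k (≰⇒> s≰k)))
    r<n : r < n
    r<n = m<n⇒m<1+n r<k

  ascent-covered : ∀ {j g} (u : GenUnfolding j g) (X : SignedPerm n) →
    Ascent (ι X) (testIndex u) → ∀ s → Covers u s → Ascent (ι X) s
  ascent-covered (pair t _ _ _ _ _) X asc s (inj₁ s≡t) =
    subst (Ascent (ι X)) (toℕ-injective (sym s≡t)) asc
  ascent-covered (pair t t′ _ t+t′≡2k t<k _) X asc s (inj₂ s≡t′) =
    subst (Ascent (ι X)) (toℕ-injective (sym s≡t′)) (PairStep.ascent-mirror t t′ t+t′≡2k t<k X asc)
  ascent-covered (single t _ _ _) X asc s s≡t =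
    subst (Ascent (ι X)) (toℕ-injective (sym s≡t)) asc

  no-descent⇒idB : ∀ (X : SignedPerm n) → (∀ j → Ascent (ι X) (testIndex (genUnfolding j))) → X ≈B idB
  no-descent⇒idB X asc x = encode-injective (begin
    encode (fun X x)                       ≡⟨ cong (encode ∘ fun X) (sym (decode-encode x)) ⟩
    ι X ⟨$⟩ʳ encode x                      ≡⟨ ι-X≈id (encode x) ⟩
    encode x                               ∎)
    where
    open ≡-Reasoning
    ι-X≈id : ι X Perm.≈ Perm.id
    ι-X≈id = no-descent⇒id (ι X) (λ s → let (j , covered) = every-index-covered s in
      ascent-covered (genUnfolding j) X (asc j) s covered)

  lengthB-bounded : ∀ (X : SignedPerm n) → lengthB X ≤ (n + n) * (n + n)
  lengthB-bounded X = begin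
    ⌊ weight (ι X) /2⌋  ≤⟨ ⌊n/2⌋-mono (+-mono-≤ (inversions-bounded (ι X))
                             (≤-trans (rank-≤ (value (ι X)) n n) (m≤m*n (n + n) (n + n)))) ⟩
    ⌊ M + M /2⌋         ≡⟨ sym (n≡⌊n+n/2⌋ M) ⟩
    M                   ∎
    where
    open ≤-Reasoning
    M = (n + n) * (n + n)

  module BLength = CoxeterLength (Hyp n)

  lengthFunctionB : BLength.LengthFunction
  lengthFunctionB = record
    { ≈-isEquivalence = record { refl = λ _ → refl ; sym = λ e x → sym (e x) ; trans = λ e f x → trans (e x) (f x) }
    ; gen-·-cong      = λ a e x → cong (fun (genB n a)) (e x)
    ; L               = lengthB
    ; L-cong          = λ {X} {X′} → lengthB-cong {X} {X′}
    ; L-e             = cong ⌊_/2⌋ (trans (weight-cong {ι (idB {n})} {Perm.id} ι-idB)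
                                          (cong₂ _+_ inversions-id (rank-toℕ {n + n} {n} ≤-refl)))
    ; L-gen           = L-gen
    ; L-descent       = L-descent
    ; L-bounded       = lengthB-bounded
    }
    where
    lengthB-cong : ∀ {X X′ : SignedPerm n} → X ≈B X′ → lengthB X ≡ lengthB X′
    lengthB-cong {X} {X′} X≈X′ = cong ⌊_/2⌋ (weight-cong {ι X} {ι X′} (ι-cong {X} {X′} X≈X′))
    L-gen : ∀ a (X : SignedPerm n) → lengthB (genB n a ·B X) ≡ suc (lengthB X) ⊎ suc (lengthB (genB n a ·B X)) ≡ lengthB X
    L-gen a X with posⱼ (ι X) (testIndex (genUnfolding a)) <? posⱼ₊₁ (ι X) (testIndex (genUnfolding a))
    ... | yes asc  = inj₁ (lengthB-ascent (genUnfolding a) X asc)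
    ... | no ¬asc = inj₂ (lengthB-descent (genUnfolding a) X (¬Ascent⇒Descent (ι X) _ ¬asc))
    L-descent : ∀ (X : SignedPerm n) → X ≈B idB ⊎
      Σ[ a ∈ Fin n ] Σ[ X′ ∈ SignedPerm n ] X ≈B (genB n a ·B X′) × lengthB X ≡ suc (lengthB X′)
    L-descent X with any? (λ a → posⱼ₊₁ (ι X) (testIndex (genUnfolding a)) <? posⱼ (ι X) (testIndex (genUnfolding a)))
    ... | yes (a , desc) = inj₂ (a , genB n a ·B X , (λ x → sym (gen-involutive (genUnfolding a) (fun X x))) ,
                                 sym (lengthB-descent (genUnfolding a) X desc))
    ... | no ¬desc = inj₁ (no-descent⇒idB X (λ a →
      ≤∧≢⇒< (≮⇒≥ (λ desc → ¬desc (a , desc))) (posⱼ≢posⱼ₊₁ (ι X) (testIndex (genUnfolding a)))))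

  open MinPlus (n + n)

  unfoldedRank : ∀ {j g} → GenUnfolding j g → Mat
  unfoldedRank (pair t t′ _ _ _ _) = rankMatrix (gen t) ⊙ rankMatrix (gen t′)
  unfoldedRank (single t _ _ _)    = rankMatrix (gen t)

  rankMatrix-unfolded-ascent : ∀ {j g} (u : GenUnfolding j g) (X : SignedPerm n) →
    Ascent (ι X) (testIndex u) → rankMatrix (unfolded u (ι X)) ≐ (unfoldedRank u ⊙ rankMatrix (ι X))
  rankMatrix-unfolded-ascent (pair t t′ _ t+t′≡2k t<k _) X asc = begin
    rankMatrix (gen t · (gen t′ · ι X))
      ≈⟨ rankMatrix-gen·-ascent t (gen t′ · ι X) (ascent-unmoved asc) ⟩
    rankMatrix (gen t) ⊙ rankMatrix (gen t′ · ι X)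
      ≈⟨ ⊙-congʳ (rankMatrix (gen t)) (rankMatrix-gen·-ascent t′ (ι X) (ascent-mirror asc)) ⟩
    rankMatrix (gen t) ⊙ (rankMatrix (gen t′) ⊙ rankMatrix (ι X))
      ≈⟨ ≐-sym (⊙-assoc _ _ _) ⟩
    (rankMatrix (gen t) ⊙ rankMatrix (gen t′)) ⊙ rankMatrix (ι X) ∎
    where
    open SetoidReasoning (Semigroup.setoid minPlusSemigroup)
    open PairStep t t′ t+t′≡2k t<k X
  rankMatrix-unfolded-ascent (single t _ _ _) X asc = rankMatrix-gen·-ascent t (ι X) asc

  rankMatrix-unfolded-descent : ∀ {j g} (u : GenUnfolding j g) (X : SignedPerm n) →
    Descent (ι X) (testIndex u) → rankMatrix (ι X) ≐ (unfoldedRank u ⊙ rankMatrix (ι X))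
  rankMatrix-unfolded-descent (pair t t′ _ t+t′≡2k t<k _) X desc = begin
    rankMatrix (ι X)
      ≈⟨ rankMatrix-descent t (ι X) desc ⟩
    rankMatrix (gen t) ⊙ rankMatrix (ι X)
      ≈⟨ ⊙-congʳ (rankMatrix (gen t)) (rankMatrix-descent t′ (ι X) (descent-mirror desc)) ⟩
    rankMatrix (gen t) ⊙ (rankMatrix (gen t′) ⊙ rankMatrix (ι X))
      ≈⟨ ≐-sym (⊙-assoc _ _ _) ⟩
    (rankMatrix (gen t) ⊙ rankMatrix (gen t′)) ⊙ rankMatrix (ι X) ∎
    where
    open SetoidReasoning (Semigroup.setoid minPlusSemigroup)
    open PairStep t t′ t+t′≡2k t<k X
  rankMatrix-unfolded-descent (single t _ _ _) X desc = rankMatrix-descent t (ι X) desc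

  module BCoxeter = Coxeter (Hyp n)

  rankMatrix-ι-⋆gen : ∀ a (X : SignedPerm n) → rankMatrix (ι (a BCoxeter.⋆gen X)) ≐ (unfoldedRank (genUnfolding a) ⊙ rankMatrix (ι X))
  rankMatrix-ι-⋆gen a X with posⱼ (ι X) (testIndex (genUnfolding a)) <? posⱼ₊₁ (ι X) (testIndex (genUnfolding a))
  ... | yes asc rewrite BLength.⋆gen-ascent lengthFunctionB a X (lengthB-ascent (genUnfolding a) X asc) =
    ≐-trans (rankMatrix-cong {_} {ι (genB n a ·B X)} {unfolded (genUnfolding a) (ι X)} (ι-·B (genUnfolding a) X))
            (rankMatrix-unfolded-ascent (genUnfolding a) X asc)
  ... | no ¬asc with ¬Ascent⇒Descent (ι X) (testIndex (genUnfolding a)) ¬asc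
  ...   | desc rewrite BLength.⋆gen-descent lengthFunctionB a X (lengthB-descent (genUnfolding a) X desc) =
    rankMatrix-unfolded-descent (genUnfolding a) X desc

  rankMatrix-ι-⋆B : ∀ w v → rankMatrix (ι (w ⋆B v)) ≐ (rankMatrix (ι w) ⊙ rankMatrix (ι v))
  rankMatrix-ι-⋆B = BLength.⋆-homomorphism lengthFunctionB minPlusSemigroup (rankMatrix ∘ ι) (unfoldedRank ∘ genUnfolding)
    (λ {X} {X′} X≈X′ → rankMatrix-cong {_} {ι X} {ι X′} (ι-cong {X} {X′} X≈X′)) ι-idB-⊙ rankMatrix-ι-⋆gen
    where
    ι-idB-⊙ : ∀ (X : SignedPerm n) → rankMatrix (ι X) ≐ (rankMatrix (ι (idB {n})) ⊙ rankMatrix (ι X))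
    ι-idB-⊙ X = ≐-trans (≐-sym (rankMatrix-id-⊙ (ι X)))
      (⊙-congˡ (rankMatrix (ι X)) (≐-sym (rankMatrix-cong {_} {ι (idB {n})} {Perm.id} ι-idB)))

  ι-⋆ : ∀ w v → ι (w ⋆B v) Perm.≈ (ι w ⋆S ι v)
  ι-⋆ w v = rankMatrix-injective (ι (w ⋆B v)) (ι w ⋆S ι v) (≐-trans (rankMatrix-ι-⋆B w v) (≐-sym (rankMatrix-⋆ (ι w) (ι v))))

open import Data.Fin.Permutation using (_≈_)

lemma4p2 : (n : ℕ) → 1 ≤ n → (w v : SignedPerm n) →
    ι (w ⋆B v) ≈ (ι w ⋆S ι v)
lemma4p2 zero    ()
lemma4p2 (suc k) _ = Hyperoctahedral.ι-⋆ k
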